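{- Let $H$ be a directed graph with at least two arcs. Let $D$ be an arc-weighted directed multigraph with weight function $w$, let $c:E(D)\to[0,1]$ be a fractional $H$-cover of $D$ of minimum value, and let $\alpha>0$. Suppose that there is an arc $e$ of $D$ with $c(e)\ge \alpha$. If $\tau_H(D\setminus e)\le \alpha^{ -1}\nu_H^*(D\setminus e)$, then $\tau_H(D)\le \alpha^{ -1}\nu_H^*(D)$.
   Context: Directed multigraphs have no loops but may have parallel arcs and directed 2-cycles; an arc-weighted one has non-negative weights $w(e)$ on arcs. An $H$-copy in $D$ is a subgraph isomorphic to $H$. $D\setminus e$ is obtained by deleting the arc $e$ (keeping all vertices and the weights of the other arcs). A fractional $H$-cover of $D$ is a function $c:E(D)\to[0,1]$ such that for every $H$-copy $X$, $\sum_{e\in E(X)} c(e)\ge 1$; its value is $\sum_{e} w(e)c(e)$. $\tau_H(D)$ is the minimum total weight of a set $F$ of arcs such that deleting $F$ leaves no $H$-copy. A fractional $H$-packing is a function $m$ from the $H$-copies to $[0,\infty)$ such that for every arc $e$ the sum of $m(X)$ over $H$-copies $X$ containing $e$ is at most $w(e)$; $\nu_H^*(D)$ is the maximum of $\sum_X m(X)$. -}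

module Defs where

open import Level using (0ℓ)
open import Data.Nat using (ℕ; zero; suc)
open import Data.Fin using (Fin; zero; suc; punchIn)
open import Data.Vec using (Vec; []; _∷_; lookup)
open import Data.Bool using (Bool; true; false; if_then_else_)
open import Data.List using (List; []; _∷_; map; _++_; foldr)
open import Data.Product using (Σ; ∃; _×_; _,_)
open import Relation.Binary.PropositionalEquality using (_≡_; _≢_)
open import Relation.Nullary using (¬_)
open import Function using (_∘_)
open import Function.Definitions using (Injective)
open import Algebra.Structures using (IsCommutativeRing)
open import Relation.Binary.Structures using (IsTotalOrder)

-- Ordered fields (the paper works over ℝ; ℝ is not available, so the
-- statement is made for every ordered field, which contains the ℝ case).

record OrderedField : Set₁ where
  infixl 6 _+_
  infixl 7 _*_
  infix 4 _≤_
  field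
    Carrier : Set
    0# 1#   : Carrier
    _+_ _*_ : Carrier → Carrier → Carrier
    -_      : Carrier → Carrier
    _⁻¹     : Carrier → Carrier      -- total; 0 ⁻¹ is unspecified
    _≤_     : Carrier → Carrier → Set
    isCommutativeRing : IsCommutativeRing _≡_ _+_ _*_ -_ 0# 1#
    0≢1     : 0# ≢ 1#
    ⁻¹-inverse : ∀ x → x ≢ 0# → x * (x ⁻¹) ≡ 1#
    isTotalOrder : IsTotalOrder _≡_ _≤_
    +-mono-≤ : ∀ {x y} z → x ≤ y → x + z ≤ y + z
    *-nonneg : ∀ {x y} → 0# ≤ x → 0# ≤ y → 0# ≤ x * y

  _<_ : Carrier → Carrier → Set
  x < y = x ≤ y × x ≢ y

Subset : ℕ → Set
Subset m = Vec Bool m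

allSubsets : (m : ℕ) → List (Subset m)
allSubsets zero    = [] ∷ []
allSubsets (suc m) = map (true ∷_) (allSubsets m) ++ map (false ∷_) (allSubsets m)

record Digraph (k h : ℕ) : Set where
  field
    tl hd  : Fin h → Fin k
    noLoop : ∀ a → tl a ≢ hd a
    noParallel : ∀ a b → tl a ≡ tl b → hd a ≡ hd b → a ≡ b

module WithField (F : OrderedField) where
  open OrderedField F

  sumFin : ∀ {m} → (Fin m → Carrier) → Carrier
  sumFin {zero}  f = 0#
  sumFin {suc m} f = f zero + sumFin (f ∘ suc)

  sumList : List Carrier → Carrier
  sumList = foldr _+_ 0#

  record WMultigraph (n m : ℕ) : Set where
    field
      tl hd  : Fin m → Fin n
      noLoop : ∀ e → tl e ≢ hd e
      w      : Fin m → Carrier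
      w≥0    : ∀ e → 0# ≤ w e

  open WMultigraph

  deleteArc : ∀ {n m} → WMultigraph n (suc m) → Fin (suc m) → WMultigraph n m
  deleteArc D e = record
    { tl = tl D ∘ punchIn e
    ; hd = hd D ∘ punchIn e
    ; noLoop = λ a → noLoop D (punchIn e a)
    ; w = w D ∘ punchIn e
    ; w≥0 = λ a → w≥0 D (punchIn e a)
    }

  -- S ⊆ E(D) is the arc set of an H-copy in D: there is a subgraph of D
  -- isomorphic to H, i.e. injective vertex map φ and injective arc map ψ
  -- respecting incidences, whose arc image is exactly S.
  IsHCopy : ∀ {k h n m} → Digraph k h → WMultigraph n m → Subset m → Set
  IsHCopy {k} {h} {n} {m} H D S =
    Σ (Fin k → Fin n) λ φ → Σ (Fin h → Fin m) λ ψ →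
      Injective _≡_ _≡_ φ × Injective _≡_ _≡_ ψ ×
      (∀ a → tl D (ψ a) ≡ φ (Digraph.tl H a)) ×
      (∀ a → hd D (ψ a) ≡ φ (Digraph.hd H a)) ×
      (∀ e → (lookup S e ≡ true → ∃ λ a → ψ a ≡ e) × (∀ a → lookup S (ψ a) ≡ true))

  sumOver : ∀ {m} → Subset m → (Fin m → Carrier) → Carrier
  sumOver S f = sumFin (λ e → if lookup S e then f e else 0#)

  IsFracCover : ∀ {k h n m} → Digraph k h → WMultigraph n m → (Fin m → Carrier) → Set
  IsFracCover {m = m} H D c =
    (∀ e → 0# ≤ c e × c e ≤ 1#) ×
    (∀ (S : Subset m) → IsHCopy H D S → 1# ≤ sumOver S c)

  coverValue : ∀ {n m} → WMultigraph n m → (Fin m → Carrier) → Carrier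
  coverValue D c = sumFin (λ e → w D e * c e)

  IsMinFracCover : ∀ {k h n m} → Digraph k h → WMultigraph n m → (Fin m → Carrier) → Set
  IsMinFracCover H D c =
    IsFracCover H D c × (∀ c' → IsFracCover H D c' → coverValue D c ≤ coverValue D c')

  IsHTransversal : ∀ {k h n m} → Digraph k h → WMultigraph n m → Subset m → Set
  IsHTransversal {m = m} H D F =
    ∀ (S : Subset m) → IsHCopy H D S → ∃ λ e → lookup S e ≡ true × lookup F e ≡ true

  IsTau : ∀ {k h n m} → Digraph k h → WMultigraph n m → Carrier → Set
  IsTau {m = m} H D T =
    (∃ λ (F : Subset m) → IsHTransversal H D F × sumOver F (w D) ≡ T) ×
    (∀ (F : Subset m) → IsHTransversal H D F → T ≤ sumOver F (w D))

  -- fractional H-packing; H-copies are represented by their arc sets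
  IsFracPacking : ∀ {k h n m} → Digraph k h → WMultigraph n m → (Subset m → Carrier) → Set
  IsFracPacking {m = m} H D p =
    (∀ S → 0# ≤ p S) ×
    (∀ S → ¬ IsHCopy H D S → p S ≡ 0#) ×
    (∀ e → sumList (map (λ S → if lookup S e then p S else 0#) (allSubsets m)) ≤ w D e)

  packingValue : ∀ {m} → (Subset m → Carrier) → Carrier
  packingValue {m} p = sumList (map p (allSubsets m))

  IsNuStar : ∀ {k h n m} → Digraph k h → WMultigraph n m → Carrier → Set
  IsNuStar H D N =
    (∃ λ p → IsFracPacking H D p × packingValue p ≡ N) ×
    (∀ p → IsFracPacking H D p → packingValue p ≤ N)

-- Adding e to a minimum transversal of D ∖ e gives τ(D) ≤ w(e) + τ(D ∖ e) ≤ w(e) + α⁻¹ ν*(D ∖ e). By LP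
-- duality the minimum fractional cover c has value ν*(D); its restriction to D ∖ e is a cover of value
-- ν*(D) − w(e) c(e) ≤ ν*(D) − α w(e), so ν*(D ∖ e) ≤ ν*(D) − α w(e) and τ(D) ≤ α⁻¹ ν*(D).
--
-- Over an arbitrary ordered field, LP duality for fractional packings (and the existence of ν*) comes
-- from Fourier–Motzkin elimination of the packing variables p S from the packing LP: the least upper
-- bound on the packing value that survives is attained by back-substitution, and the combination of
-- inequalities attaining it is a cover of the same value.

module Submission where

open import Defs
open import Data.Nat using (ℕ; suc)
open import Data.Fin using (Fin)
open import Relation.Binary.Definitions using (DecidableEquality)
open import Relation.Nullary using (Dec)

module OrderedFieldProperties (F : OrderedField) where

  open import Level using (0ℓ)
  open import Algebra.Bundles using (CommutativeRing)
  open import Algebra.Structures using (IsCommutativeRing)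
  open import Relation.Binary.Bundles using (TotalOrder)
  open import Relation.Binary.Structures using (IsTotalOrder)
  open import Relation.Binary.PropositionalEquality
  open import Data.Empty using (⊥-elim)
  open import Data.Maybe using (Maybe; just; nothing)
  open import Data.Nat as ℕ using (zero)
  import Data.Nat.Properties as ℕ
  open import Data.Integer as ℤ using (ℤ; -[1+_]; _⊖_; 0ℤ; 1ℤ; -1ℤ; ∣_∣; sign)
  import Data.Integer.Properties as ℤ
  open import Data.Sign as Sign using (Sign)
  open import Data.Product using (_×_; _,_)
  open import Data.Sum using (_⊎_; inj₁; inj₂)
  open import Relation.Nullary using (¬_; yes; no)
  import Algebra.Solver.Ring.AlmostCommutativeRing as ACR
  import Algebra.Solver.Ring as RingSolver
  import Algebra.Properties.Ring as RingProperties
  import Algebra.Properties.Semiring.Mult.TCOptimised as SemiringMult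
  import Algebra.Construct.NaturalChoice.Min as NaturalMin
  import Relation.Binary.Reasoning.PartialOrder as PartialOrderReasoning

  open OrderedField F public renaming (+-mono-≤ to +-monoˡ-≤)
  open IsCommutativeRing isCommutativeRing public
    using ( +-assoc; +-comm; +-identityˡ; +-identityʳ; -‿inverseʳ
          ; *-assoc; *-comm; *-identityˡ; *-identityʳ; distribˡ; distribʳ; zeroˡ; zeroʳ )
  open IsTotalOrder isTotalOrder public
    using (total; antisym) renaming (refl to ≤-refl; trans to ≤-trans; reflexive to ≤-reflexive)

  commutativeRing : CommutativeRing 0ℓ 0ℓ
  commutativeRing = record { isCommutativeRing = isCommutativeRing }

  totalOrder : TotalOrder 0ℓ 0ℓ 0ℓ
  totalOrder = record { isTotalOrder = isTotalOrder }

  open RingProperties (CommutativeRing.ring commutativeRing) public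
    using (-‿involutive; -0#≈0#; -‿+-comm; -‿distribˡ-*; -‿distribʳ-*)
  open SemiringMult (CommutativeRing.semiring commutativeRing) using (1+×; ×-homo-+; ×1-homo-*) renaming (_×_ to _×ₙ_)
  open NaturalMin totalOrder public using (_⊓_; x⊓y≤x; x⊓y≤y; ⊓-glb; x≤y⇒x⊓y≈x; x≤y⇒y⊓x≈x)
  open ≡-Reasoning

  fromℕ : ℕ → Carrier
  fromℕ n = n ×ₙ 1#

  fromℕ-suc : ∀ n → fromℕ (suc n) ≡ 1# + fromℕ n
  fromℕ-suc n = 1+× n 1#

  fromℕ-+ : ∀ m n → fromℕ (m ℕ.+ n) ≡ fromℕ m + fromℕ n
  fromℕ-+ = ×-homo-+ 1#

  fromℕ-* : ∀ m n → fromℕ (m ℕ.* n) ≡ fromℕ m * fromℕ n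
  fromℕ-* = ×1-homo-*

  infixl 6 _-_
  _-_ : Carrier → Carrier → Carrier
  x - y = x + - y

  x+y≡z⇒x≡z-y : ∀ {x y z} → x + y ≡ z → x ≡ z - y
  x+y≡z⇒x≡z-y {x} {y} {z} x+y≡z = begin
    x              ≡⟨ sym (+-identityʳ x) ⟩
    x + 0#         ≡⟨ cong (x +_) (sym (-‿inverseʳ y)) ⟩
    x + (y - y)    ≡⟨ sym (+-assoc x y (- y)) ⟩
    (x + y) - y    ≡⟨ cong (_- y) x+y≡z ⟩
    z - y          ∎

  fromℕ-∸ : ∀ {m n} → n ℕ.≤ m → fromℕ (m ℕ.∸ n) ≡ fromℕ m - fromℕ n
  fromℕ-∸ {m} {n} n≤m = x+y≡z⇒x≡z-y (trans (sym (fromℕ-+ (m ℕ.∸ n) n)) (cong fromℕ (ℕ.m∸n+n≡m n≤m)))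

  -- The ring solver needs coefficients with decidable equality, so constants enter through ℤ.
  fromℤ : ℤ → Carrier
  fromℤ (ℤ.+ n)  = fromℕ n
  fromℤ -[1+ n ] = - fromℕ (suc n)

  fromℤ-negate : ∀ i → fromℤ (ℤ.- i) ≡ - fromℤ i
  fromℤ-negate (ℤ.+ zero)  = sym -0#≈0#
  fromℤ-negate (ℤ.+ suc n) = refl
  fromℤ-negate -[1+ n ]    = sym (-‿involutive _)

  private
    fromℤ-⊖ : ∀ m n → fromℤ (m ⊖ n) ≡ fromℕ m - fromℕ n
    fromℤ-⊖ m n with ℕ.≤-total n m
    ... | inj₁ n≤m = trans (cong fromℤ (ℤ.⊖-≥ n≤m)) (fromℕ-∸ n≤m)
    ... | inj₂ m≤n = begin
      fromℤ (m ⊖ n)                  ≡⟨ cong fromℤ (ℤ.⊖-≤ m≤n) ⟩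
      fromℤ (ℤ.- (ℤ.+ (n ℕ.∸ m)))    ≡⟨ fromℤ-negate (ℤ.+ (n ℕ.∸ m)) ⟩
      - fromℕ (n ℕ.∸ m)              ≡⟨ cong -_ (fromℕ-∸ m≤n) ⟩
      - (fromℕ n - fromℕ m)          ≡⟨ sym (-‿+-comm (fromℕ n) (- fromℕ m)) ⟩
      - fromℕ n + - - fromℕ m        ≡⟨ +-comm _ _ ⟩
      - - fromℕ m + - fromℕ n        ≡⟨ cong (_- fromℕ n) (-‿involutive (fromℕ m)) ⟩
      fromℕ m - fromℕ n              ∎

    signed : Sign → Carrier → Carrier
    signed Sign.+ x = x
    signed Sign.- x = - x

    fromℤ-◃ : ∀ s n → fromℤ (s ℤ.◃ n) ≡ signed s (fromℕ n)
    fromℤ-◃ Sign.+ zero    = refl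
    fromℤ-◃ Sign.- zero    = sym -0#≈0#
    fromℤ-◃ Sign.+ (suc n) = refl
    fromℤ-◃ Sign.- (suc n) = refl

    signed-* : ∀ s t x y → signed (s Sign.* t) (x * y) ≡ signed s x * signed t y
    signed-* Sign.+ Sign.+ x y = refl
    signed-* Sign.+ Sign.- x y = -‿distribʳ-* x y
    signed-* Sign.- Sign.+ x y = -‿distribˡ-* x y
    signed-* Sign.- Sign.- x y = begin
      x * y           ≡⟨ sym (-‿involutive (x * y)) ⟩
      - - (x * y)     ≡⟨ cong -_ (-‿distribˡ-* x y) ⟩
      - (- x * y)     ≡⟨ -‿distribʳ-* (- x) y ⟩
      - x * - y       ∎

  fromℤ-+ : ∀ i j → fromℤ (i ℤ.+ j) ≡ fromℤ i + fromℤ j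
  fromℤ-+ -[1+ m ] -[1+ n ] = begin
    - fromℕ (suc (suc (m ℕ.+ n)))          ≡⟨ cong (λ k → - fromℕ (suc k)) (sym (ℕ.+-suc m n)) ⟩
    - fromℕ (suc m ℕ.+ suc n)              ≡⟨ cong -_ (fromℕ-+ (suc m) (suc n)) ⟩
    - (fromℕ (suc m) + fromℕ (suc n))      ≡⟨ sym (-‿+-comm (fromℕ (suc m)) (fromℕ (suc n))) ⟩
    - fromℕ (suc m) + - fromℕ (suc n)      ∎
  fromℤ-+ -[1+ m ] (ℤ.+ n)  = trans (fromℤ-⊖ n (suc m)) (+-comm _ _)
  fromℤ-+ (ℤ.+ m)  -[1+ n ] = fromℤ-⊖ m (suc n)
  fromℤ-+ (ℤ.+ m)  (ℤ.+ n)  = fromℕ-+ m n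

  fromℤ-* : ∀ i j → fromℤ (i ℤ.* j) ≡ fromℤ i * fromℤ j
  fromℤ-* i j = begin
    fromℤ (i ℤ.* j)
      ≡⟨ fromℤ-◃ (sign i Sign.* sign j) (∣ i ∣ ℕ.* ∣ j ∣) ⟩
    signed (sign i Sign.* sign j) (fromℕ (∣ i ∣ ℕ.* ∣ j ∣))
      ≡⟨ cong (signed (sign i Sign.* sign j)) (fromℕ-* ∣ i ∣ ∣ j ∣) ⟩
    signed (sign i Sign.* sign j) (fromℕ ∣ i ∣ * fromℕ ∣ j ∣)
      ≡⟨ signed-* (sign i) (sign j) (fromℕ ∣ i ∣) (fromℕ ∣ j ∣) ⟩
    signed (sign i) (fromℕ ∣ i ∣) * signed (sign j) (fromℕ ∣ j ∣)
      ≡⟨ sym (cong₂ _*_ (fromℤ-sign i) (fromℤ-sign j)) ⟩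
    fromℤ i * fromℤ j ∎
    where
    fromℤ-sign : ∀ i → fromℤ i ≡ signed (sign i) (fromℕ ∣ i ∣)
    fromℤ-sign i = trans (cong fromℤ (sym (ℤ.◃-inverse i))) (fromℤ-◃ (sign i) ∣ i ∣)

  private
    almostCommutativeRing : ACR.AlmostCommutativeRing 0ℓ 0ℓ
    almostCommutativeRing = ACR.fromCommutativeRing commutativeRing

    fromℤ-morphism : ℤ.+-*-rawRing ACR.-Raw-AlmostCommutative⟶ almostCommutativeRing
    fromℤ-morphism = record
      { ⟦_⟧ = fromℤ ; +-homo = fromℤ-+ ; *-homo = fromℤ-* ; -‿homo = fromℤ-negate ; 0-homo = refl ; 1-homo = refl }

    fromℤ-≟ : ∀ i j → Maybe (fromℤ i ≡ fromℤ j)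
    fromℤ-≟ i j with i ℤ.≟ j
    ... | yes refl = just refl
    ... | no _     = nothing

  open RingSolver ℤ.+-*-rawRing almostCommutativeRing fromℤ-morphism fromℤ-≟ public
    using (solve; _:=_; _:+_; _:*_; :-_; _:-_; con)

  module ≤-Reasoning = PartialOrderReasoning (TotalOrder.poset totalOrder)

  +-monoʳ-≤ : ∀ z {x y} → x ≤ y → z + x ≤ z + y
  +-monoʳ-≤ z {x} {y} x≤y = subst₂ _≤_ (+-comm x z) (+-comm y z) (+-monoˡ-≤ z x≤y)

  +-mono-≤ : ∀ {x y u v} → x ≤ y → u ≤ v → x + u ≤ y + v
  +-mono-≤ {y = y} {u} x≤y u≤v = ≤-trans (+-monoˡ-≤ u x≤y) (+-monoʳ-≤ y u≤v)

  x≤y⇒0≤y-x : ∀ {x y} → x ≤ y → 0# ≤ y - x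
  x≤y⇒0≤y-x {x} {y} x≤y = subst (_≤ y - x) (-‿inverseʳ x) (+-monoˡ-≤ (- x) x≤y)

  0≤y-x⇒x≤y : ∀ {x y} → 0# ≤ y - x → x ≤ y
  0≤y-x⇒x≤y {x} {y} 0≤y-x =
    subst₂ _≤_ (+-identityˡ x) (solve 2 (λ x y → (y :- x) :+ x := y) refl x y) (+-monoˡ-≤ x 0≤y-x)

  neg-antimono-≤ : ∀ {x y} → x ≤ y → - y ≤ - x
  neg-antimono-≤ {x} {y} x≤y =
    0≤y-x⇒x≤y (subst (0# ≤_) (solve 2 (λ x y → y :- x := (:- x) :- (:- y)) refl x y) (x≤y⇒0≤y-x x≤y))

  0≤x⇒-x≤0 : ∀ {x} → 0# ≤ x → - x ≤ 0#
  0≤x⇒-x≤0 0≤x = subst (_ ≤_) -0#≈0# (neg-antimono-≤ 0≤x)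

  x≤0⇒0≤-x : ∀ {x} → x ≤ 0# → 0# ≤ - x
  x≤0⇒0≤-x x≤0 = subst (_≤ _) -0#≈0# (neg-antimono-≤ x≤0)

  *-monoʳ-≤-nonNeg : ∀ {x y} z → 0# ≤ z → x ≤ y → z * x ≤ z * y
  *-monoʳ-≤-nonNeg {x} {y} z 0≤z x≤y = 0≤y-x⇒x≤y
    (subst (0# ≤_) (solve 3 (λ x y z → z :* (y :- x) := z :* y :- z :* x) refl x y z) (*-nonneg 0≤z (x≤y⇒0≤y-x x≤y)))

  0≤1 : 0# ≤ 1#
  0≤1 with total 0# 1#
  ... | inj₁ 0≤1 = 0≤1
  ... | inj₂ 1≤0 = subst (0# ≤_) (solve 0 ((:- con 1ℤ) :* (:- con 1ℤ) := con 1ℤ) refl) (*-nonneg 0≤-1 0≤-1)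
    where
    0≤-1 : 0# ≤ - 1#
    0≤-1 = x≤0⇒0≤-x 1≤0

  1≰0 : ¬ (1# ≤ 0#)
  1≰0 1≤0 = 0≢1 (antisym 0≤1 1≤0)

  x*x⁻¹≡1 : ∀ {x} → 0# < x → x * x ⁻¹ ≡ 1#
  x*x⁻¹≡1 (_ , 0≢x) = ⁻¹-inverse _ (λ x≡0 → 0≢x (sym x≡0))

  x⁻¹*x≡1 : ∀ {x} → 0# < x → x ⁻¹ * x ≡ 1#
  x⁻¹*x≡1 0<x = trans (*-comm _ _) (x*x⁻¹≡1 0<x)

  x*[x⁻¹*y]≡y : ∀ {x} y → 0# < x → x * (x ⁻¹ * y) ≡ y
  x*[x⁻¹*y]≡y {x} y 0<x = begin
    x * (x ⁻¹ * y)   ≡⟨ sym (*-assoc x (x ⁻¹) y) ⟩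
    (x * x ⁻¹) * y   ≡⟨ cong (_* y) (x*x⁻¹≡1 0<x) ⟩
    1# * y           ≡⟨ *-identityˡ y ⟩
    y                ∎

  ⁻¹-nonNeg : ∀ {x} → 0# < x → 0# ≤ x ⁻¹
  ⁻¹-nonNeg {x} 0<x@(0≤x , _) with total 0# (x ⁻¹)
  ... | inj₁ 0≤x⁻¹ = 0≤x⁻¹
  ... | inj₂ x⁻¹≤0 = ⊥-elim (1≰0 (subst (_≤ 0#) (x*x⁻¹≡1 0<x) x*x⁻¹≤0))
    where
    x*x⁻¹≤0 : x * x ⁻¹ ≤ 0#
    x*x⁻¹≤0 = subst₂ _≤_ (solve 2 (λ x i → :- (x :* (:- i)) := x :* i) refl x (x ⁻¹)) -0#≈0#
      (neg-antimono-≤ (*-nonneg 0≤x (x≤0⇒0≤-x x⁻¹≤0)))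

  fromℕ-nonNeg : ∀ n → 0# ≤ fromℕ n
  fromℕ-nonNeg zero    = ≤-refl
  fromℕ-nonNeg (suc n) = subst₂ _≤_ (+-identityˡ 0#) (sym (fromℕ-suc n)) (+-mono-≤ 0≤1 (fromℕ-nonNeg n))

  fromℕ-pos : ∀ {n} → 0 ℕ.< n → 0# < fromℕ n
  fromℕ-pos {suc n} _ = fromℕ-nonNeg (suc n) , λ 0≡1+n →
    1≰0 (subst₂ _≤_ (+-identityʳ 1#) (trans (sym (fromℕ-suc n)) (sym 0≡1+n)) (+-monoʳ-≤ 1# (fromℕ-nonNeg n)))

  fromℤ-positive : ∀ {c} → 0ℤ ℤ.< c → fromℤ c ≡ fromℕ ∣ c ∣
  fromℤ-positive {ℤ.+ n} _ = refl

  fromℤ-negative : ∀ {c} → c ℤ.< 0ℤ → fromℤ c ≡ - fromℕ ∣ c ∣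
  fromℤ-negative { -[1+ n ]} _ = refl
  fromℤ-negative {ℤ.+ n} (ℤ.+<+ ())

  fromℤ-nonPositive : ∀ {c} → ¬ (0ℤ ℤ.< c) → fromℤ c ≤ 0#
  fromℤ-nonPositive {ℤ.+ zero}    _   = ≤-refl
  fromℤ-nonPositive {ℤ.+ suc n}   0≮c = ⊥-elim (0≮c (ℤ.+<+ (ℕ.s≤s ℕ.z≤n)))
  fromℤ-nonPositive { -[1+ n ]}   _   = 0≤x⇒-x≤0 (fromℕ-nonNeg (suc n))

  0<c⇒0<∣c∣ : ∀ {c} → 0ℤ ℤ.< c → 0# < fromℕ ∣ c ∣
  0<c⇒0<∣c∣ {ℤ.+ n} (ℤ.+<+ 0<n) = fromℕ-pos 0<n

  c<0⇒0<∣c∣ : ∀ {c} → c ℤ.< 0ℤ → 0# < fromℕ ∣ c ∣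
  c<0⇒0<∣c∣ { -[1+ n ]} _ = fromℕ-pos {suc n} (ℕ.s≤s ℕ.z≤n)
  c<0⇒0<∣c∣ {ℤ.+ n} (ℤ.+<+ ())

  0≤y*r+x*s⇒-[s/y]≤r/x : ∀ {x y r s} → 0# < x → 0# < y → 0# ≤ y * r + x * s → - (y ⁻¹ * s) ≤ x ⁻¹ * r
  0≤y*r+x*s⇒-[s/y]≤r/x {x} {y} {r} {s} 0<x 0<y 0≤yr+xs =
    0≤y-x⇒x≤y (subst (0# ≤_) scaled (*-nonneg (*-nonneg (⁻¹-nonNeg 0<x) (⁻¹-nonNeg 0<y)) 0≤yr+xs))
    where
    scaled : (x ⁻¹ * y ⁻¹) * (y * r + x * s) ≡ x ⁻¹ * r - - (y ⁻¹ * s)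
    scaled = begin
      (x ⁻¹ * y ⁻¹) * (y * r + x * s)
        ≡⟨ solve 6 (λ i j x y r s → (i :* j) :* (y :* r :+ x :* s) := i :* ((j :* y) :* r) :+ j :* ((i :* x) :* s))
                 refl (x ⁻¹) (y ⁻¹) x y r s ⟩
      x ⁻¹ * ((y ⁻¹ * y) * r) + y ⁻¹ * ((x ⁻¹ * x) * s)
        ≡⟨ cong₂ (λ u v → x ⁻¹ * (u * r) + y ⁻¹ * (v * s)) (x⁻¹*x≡1 0<y) (x⁻¹*x≡1 0<x) ⟩
      x ⁻¹ * (1# * r) + y ⁻¹ * (1# * s)
        ≡⟨ solve 4 (λ i j r s → i :* (con 1ℤ :* r) :+ j :* (con 1ℤ :* s) := i :* r :- (:- (j :* s)))
                 refl (x ⁻¹) (y ⁻¹) r s ⟩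
      x ⁻¹ * r - - (y ⁻¹ * s) ∎

  -1*x≡-x : ∀ x → fromℤ -1ℤ * x ≡ - x
  -1*x≡-x x = solve 1 (λ x → con -1ℤ :* x := :- x) refl x

  x≤0⇒x*y≤0 : ∀ {x y} → x ≤ 0# → 0# ≤ y → x * y ≤ 0#
  x≤0⇒x*y≤0 {x} {y} x≤0 0≤y = subst₂ _≤_ (solve 2 (λ x y → :- ((:- x) :* y) := x :* y) refl x y) -0#≈0#
                                 (neg-antimono-≤ (*-nonneg (x≤0⇒0≤-x x≤0) 0≤y))

  x+1≰x : ∀ {x} → ¬ (x + 1# ≤ x)
  x+1≰x {x} x+1≤x =
    1≰0 (subst₂ _≤_ (solve 1 (λ x → (x :+ con 1ℤ) :- x := con 1ℤ) refl x) (-‿inverseʳ x) (+-monoˡ-≤ (- x) x+1≤x))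

  x⊓1-nonNeg : ∀ {x} → 0# ≤ x → 0# ≤ x ⊓ 1#
  x⊓1-nonNeg 0≤x = ⊓-glb 0≤x 0≤1

  [x+y]⊓1≤x⊓1+y⊓1 : ∀ {x y} → 0# ≤ x → 0# ≤ y → (x + y) ⊓ 1# ≤ x ⊓ 1# + y ⊓ 1#
  [x+y]⊓1≤x⊓1+y⊓1 {x} {y} 0≤x 0≤y = cases (total x 1#) (total y 1#)
    where
    cases : x ≤ 1# ⊎ 1# ≤ x → y ≤ 1# ⊎ 1# ≤ y → (x + y) ⊓ 1# ≤ x ⊓ 1# + y ⊓ 1#
    cases (inj₂ 1≤x) _ = ≤-trans (x⊓y≤y _ 1#)
      (subst₂ _≤_ (+-identityʳ 1#) (cong (_+ y ⊓ 1#) (sym (x≤y⇒y⊓x≈x 1≤x))) (+-monoʳ-≤ 1# (x⊓1-nonNeg 0≤y)))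
    cases (inj₁ _) (inj₂ 1≤y) = ≤-trans (x⊓y≤y _ 1#)
      (subst₂ _≤_ (+-identityˡ 1#) (cong (x ⊓ 1# +_) (sym (x≤y⇒y⊓x≈x 1≤y))) (+-monoˡ-≤ 1# (x⊓1-nonNeg 0≤x)))
    cases (inj₁ x≤1) (inj₁ y≤1) =
      ≤-trans (x⊓y≤x _ 1#) (≤-reflexive (sym (cong₂ _+_ (x≤y⇒x⊓y≈x x≤1) (x≤y⇒x⊓y≈x y≤1))))

  x+y⁻¹*[z-x*y]≡y⁻¹*z : ∀ {y} x z → 0# < y → x + y ⁻¹ * (z - x * y) ≡ y ⁻¹ * z
  x+y⁻¹*[z-x*y]≡y⁻¹*z {y} x z 0<y = begin
    x + y ⁻¹ * (z - x * y)
      ≡⟨ solve 4 (λ x i z y → x :+ i :* (z :- x :* y) := i :* z :+ x :* (con 1ℤ :- y :* i)) refl x (y ⁻¹) z y ⟩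
    y ⁻¹ * z + x * (1# - y * y ⁻¹)
      ≡⟨ cong (λ u → y ⁻¹ * z + x * (1# - u)) (x*x⁻¹≡1 0<y) ⟩
    y ⁻¹ * z + x * (1# - 1#)
      ≡⟨ solve 2 (λ a x → a :+ x :* (con 1ℤ :- con 1ℤ) := a) refl (y ⁻¹ * z) x ⟩
    y ⁻¹ * z ∎


module Subsets where

  open import Relation.Binary.PropositionalEquality
  open import Data.Vec using ([]; _∷_)
  import Data.Vec.Properties as Vec
  open import Data.Bool using (true; false)
  open import Data.Bool.Properties using () renaming (_≟_ to _≟ᵇ_)
  open import Data.List using (map; _++_)
  open import Data.List.Membership.Propositional using (_∈_)
  open import Data.List.Membership.Propositional.Properties using (∈-map⁺; ∈-++⁺ˡ; ∈-++⁺ʳ)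
  open import Data.List.Relation.Unary.Any using (here)

  _≟ˢ_ : ∀ {m} → DecidableEquality (Subset m)
  _≟ˢ_ = Vec.≡-dec _≟ᵇ_

  ∈-allSubsets : ∀ {m} (S : Subset m) → S ∈ allSubsets m
  ∈-allSubsets []                = here refl
  ∈-allSubsets {suc m} (true ∷ S)  = ∈-++⁺ˡ (∈-map⁺ (true ∷_) (∈-allSubsets S))
  ∈-allSubsets {suc m} (false ∷ S) = ∈-++⁺ʳ (map (true ∷_) (allSubsets m)) (∈-map⁺ (false ∷_) (∈-allSubsets S))

module FieldSums (F : OrderedField) where

  open import Relation.Binary.PropositionalEquality
  open import Data.Nat using (zero)
  open import Data.Vec using ([]; _∷_; lookup)
  open import Data.Fin using (Fin; zero; suc; punchIn)
  open import Data.Fin.Properties using (_≟_)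
  open import Data.Bool using (true; false; if_then_else_)
  open import Data.List using (List; []; _∷_; _++_; map)
  open import Relation.Nullary using (does)
  import Data.Integer as ℤ
  import Data.Integer.Properties as ℤ
  open import Function using (_∘_)
  open import Algebra.Bundles using (CommutativeRing)
  import Algebra.Properties.Semiring.Sum as SemiringSum

  open Subsets
  open OrderedFieldProperties F
  open WithField F using (sumFin; sumList; sumOver)
  open SemiringSum (CommutativeRing.semiring commutativeRing)
    using (sum; ∑-distrib-+; ∑-comm; *-distribˡ-sum; sum-remove)
  open SemiringSum ℤ.+-*-semiring public using () renaming (sum to sumℤ)
  open ≡-Reasoning

  sumFin≡sum : ∀ {m} (f : Fin m → Carrier) → sumFin f ≡ sum f
  sumFin≡sum {zero}  f = refl
  sumFin≡sum {suc m} f = cong (f zero +_) (sumFin≡sum (f ∘ suc))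

  sumFin-cong : ∀ {m} {f g : Fin m → Carrier} → (∀ i → f i ≡ g i) → sumFin f ≡ sumFin g
  sumFin-cong {zero}  f≗g = refl
  sumFin-cong {suc m} f≗g = cong₂ _+_ (f≗g zero) (sumFin-cong (f≗g ∘ suc))

  sumFin-zero : ∀ {m} (f : Fin m → Carrier) → (∀ i → f i ≡ 0#) → sumFin f ≡ 0#
  sumFin-zero {zero}  f f≗0 = refl
  sumFin-zero {suc m} f f≗0 = trans (cong₂ _+_ (f≗0 zero) (sumFin-zero (f ∘ suc) (f≗0 ∘ suc))) (+-identityˡ 0#)

  sumFin-+ : ∀ {m} (f g : Fin m → Carrier) → sumFin (λ i → f i + g i) ≡ sumFin f + sumFin g
  sumFin-+ f g = trans (sumFin≡sum (λ i → f i + g i))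
                       (trans (∑-distrib-+ f g) (sym (cong₂ _+_ (sumFin≡sum f) (sumFin≡sum g))))

  *-distribˡ-sumFin : ∀ {m} x (f : Fin m → Carrier) → sumFin (λ i → x * f i) ≡ x * sumFin f
  *-distribˡ-sumFin x f = trans (sumFin≡sum (λ i → x * f i)) (sym (trans (cong (x *_) (sumFin≡sum f)) (*-distribˡ-sum x f)))

  sumFin-comm : ∀ {m n} (f : Fin m → Fin n → Carrier) →
                sumFin (λ i → sumFin (f i)) ≡ sumFin (λ j → sumFin (λ i → f i j))
  sumFin-comm f = begin
    sumFin (λ i → sumFin (f i))          ≡⟨ sumFin-cong (λ i → sumFin≡sum (f i)) ⟩
    sumFin (λ i → sum (f i))             ≡⟨ sumFin≡sum (λ i → sum (f i)) ⟩
    sum (λ i → sum (f i))                ≡⟨ ∑-comm f ⟩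
    sum (λ j → sum (λ i → f i j))        ≡⟨ sym (sumFin≡sum (λ j → sum (λ i → f i j))) ⟩
    sumFin (λ j → sum (λ i → f i j))     ≡⟨ sym (sumFin-cong (λ j → sumFin≡sum (λ i → f i j))) ⟩
    sumFin (λ j → sumFin (λ i → f i j))  ∎

  sumFin-remove : ∀ {m} (e : Fin (suc m)) (f : Fin (suc m) → Carrier) → sumFin f ≡ f e + sumFin (f ∘ punchIn e)
  sumFin-remove e f = trans (sumFin≡sum f) (trans (sum-remove f) (sym (cong (f e +_) (sumFin≡sum (f ∘ punchIn e)))))

  sumFin-indicator : ∀ {m} (i : Fin m) (f : Fin m → Carrier) → sumFin (λ j → if does (i ≟ j) then f j else 0#) ≡ f i
  sumFin-indicator {suc m} zero    f = trans (cong (f zero +_) (sumFin-zero {m} _ (λ _ → refl))) (+-identityʳ (f zero))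
  sumFin-indicator {suc m} (suc i) f = trans (+-identityˡ _) (sumFin-indicator i (f ∘ suc))

  sumFin-mono-≤ : ∀ {m} {f g : Fin m → Carrier} → (∀ i → f i ≤ g i) → sumFin f ≤ sumFin g
  sumFin-mono-≤ {zero}  f≤g = ≤-refl
  sumFin-mono-≤ {suc m} f≤g = +-mono-≤ (f≤g zero) (sumFin-mono-≤ (f≤g ∘ suc))

  sumFin-nonNeg : ∀ {m} {f : Fin m → Carrier} → (∀ i → 0# ≤ f i) → 0# ≤ sumFin f
  sumFin-nonNeg {m} {f} 0≤f = subst (_≤ sumFin f) (sumFin-zero {m} (λ _ → 0#) (λ _ → refl)) (sumFin-mono-≤ 0≤f)

  term≤sumFin : ∀ {m} {f : Fin m → Carrier} → (∀ i → 0# ≤ f i) → ∀ i → f i ≤ sumFin f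
  term≤sumFin {suc m} {f} 0≤f zero    =
    subst (_≤ sumFin f) (+-identityʳ (f zero)) (+-monoʳ-≤ (f zero) (sumFin-nonNeg (0≤f ∘ suc)))
  term≤sumFin {suc m} {f} 0≤f (suc i) =
    subst (_≤ sumFin f) (+-identityˡ (f (suc i))) (+-mono-≤ (0≤f zero) (term≤sumFin (0≤f ∘ suc) i))

  ΣL : ∀ {A : Set} → List A → (A → Carrier) → Carrier
  ΣL xs f = sumList (map f xs)

  ΣL-cong : ∀ {A : Set} (xs : List A) {f g : A → Carrier} → (∀ a → f a ≡ g a) → ΣL xs f ≡ ΣL xs g
  ΣL-cong []       f≗g = refl
  ΣL-cong (x ∷ xs) f≗g = cong₂ _+_ (f≗g x) (ΣL-cong xs f≗g)

  ΣL-zero : ∀ {A : Set} (xs : List A) (f : A → Carrier) → (∀ a → f a ≡ 0#) → ΣL xs f ≡ 0#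
  ΣL-zero []       f f≗0 = refl
  ΣL-zero (x ∷ xs) f f≗0 = trans (cong₂ _+_ (f≗0 x) (ΣL-zero xs f f≗0)) (+-identityˡ 0#)

  ΣL-++ : ∀ {A : Set} (xs ys : List A) (f : A → Carrier) → ΣL (xs ++ ys) f ≡ ΣL xs f + ΣL ys f
  ΣL-++ []       ys f = sym (+-identityˡ _)
  ΣL-++ (x ∷ xs) ys f = trans (cong (f x +_) (ΣL-++ xs ys f)) (sym (+-assoc _ _ _))

  ΣL-map : ∀ {A B : Set} (xs : List A) (g : A → B) (f : B → Carrier) → ΣL (map g xs) f ≡ ΣL xs (f ∘ g)
  ΣL-map []       g f = refl
  ΣL-map (x ∷ xs) g f = cong (f (g x) +_) (ΣL-map xs g f)

  *-distribˡ-ΣL : ∀ {A : Set} (xs : List A) x (f : A → Carrier) → ΣL xs (λ a → x * f a) ≡ x * ΣL xs f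
  *-distribˡ-ΣL []       x f = sym (zeroʳ x)
  *-distribˡ-ΣL (a ∷ xs) x f = trans (cong (x * f a +_) (*-distribˡ-ΣL xs x f)) (sym (distribˡ x _ _))

  ΣL-neg : ∀ {A : Set} (xs : List A) (f : A → Carrier) → ΣL xs (λ a → - f a) ≡ - ΣL xs f
  ΣL-neg xs f = begin
    ΣL xs (λ a → - f a)               ≡⟨ ΣL-cong xs (λ a → sym (-1*x≡-x (f a))) ⟩
    ΣL xs (λ a → fromℤ ℤ.-1ℤ * f a)   ≡⟨ *-distribˡ-ΣL xs (fromℤ ℤ.-1ℤ) f ⟩
    fromℤ ℤ.-1ℤ * ΣL xs f             ≡⟨ -1*x≡-x (ΣL xs f) ⟩
    - ΣL xs f                         ∎

  ΣL-mono-≤ : ∀ {A : Set} (xs : List A) {f g : A → Carrier} → (∀ a → f a ≤ g a) → ΣL xs f ≤ ΣL xs g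
  ΣL-mono-≤ []       f≤g = ≤-refl
  ΣL-mono-≤ (x ∷ xs) f≤g = +-mono-≤ (f≤g x) (ΣL-mono-≤ xs f≤g)

  ΣL-sumFin-comm : ∀ {A : Set} (xs : List A) {m} (f : A → Fin m → Carrier) →
                   ΣL xs (λ a → sumFin (f a)) ≡ sumFin (λ i → ΣL xs (λ a → f a i))
  ΣL-sumFin-comm []       {m} f = sym (sumFin-zero {m} _ (λ _ → refl))
  ΣL-sumFin-comm (x ∷ xs)     f = trans (cong (sumFin (f x) +_) (ΣL-sumFin-comm xs f)) (sym (sumFin-+ (f x) _))

  ΣL-allSubsets-indicator : ∀ {n} (S : Subset n) (f : Subset n → Carrier) →
                            ΣL (allSubsets n) (λ S′ → if does (S′ ≟ˢ S) then f S′ else 0#) ≡ f S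
  ΣL-allSubsets-indicator []              f = +-identityʳ _
  ΣL-allSubsets-indicator {suc n} (t ∷ S) f = begin
    ΣL (map (true ∷_) A ++ map (false ∷_) A) g        ≡⟨ ΣL-++ (map (true ∷_) A) (map (false ∷_) A) g ⟩
    ΣL (map (true ∷_) A) g + ΣL (map (false ∷_) A) g  ≡⟨ cong₂ _+_ (ΣL-map A (true ∷_) g) (ΣL-map A (false ∷_) g) ⟩
    ΣL A (g ∘ (true ∷_)) + ΣL A (g ∘ (false ∷_))      ≡⟨ halves t ⟩
    f (t ∷ S)                                         ∎
    where
    A = allSubsets n
    g = λ S′ → if does (S′ ≟ˢ (t ∷ S)) then f S′ else 0#
    halves : ∀ t → ΣL A (λ S′ → if does ((true ∷ S′) ≟ˢ (t ∷ S)) then f (true ∷ S′) else 0#)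
                 + ΣL A (λ S′ → if does ((false ∷ S′) ≟ˢ (t ∷ S)) then f (false ∷ S′) else 0#) ≡ f (t ∷ S)
    halves true  = trans (cong₂ _+_ (ΣL-allSubsets-indicator S (f ∘ (true ∷_))) (ΣL-zero A _ (λ _ → refl))) (+-identityʳ _)
    halves false = trans (cong₂ _+_ (ΣL-zero A _ (λ _ → refl)) (ΣL-allSubsets-indicator S (f ∘ (false ∷_)))) (+-identityˡ _)

  fromℤ-sumℤ : ∀ {m} (f : Fin m → ℤ.ℤ) → fromℤ (sumℤ f) ≡ sumFin (fromℤ ∘ f)
  fromℤ-sumℤ {zero}  f = refl
  fromℤ-sumℤ {suc m} f = trans (fromℤ-+ (f zero) (sumℤ (f ∘ suc))) (cong (fromℤ (f zero) +_) (fromℤ-sumℤ (f ∘ suc)))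

  if-distrib-sumFin : ∀ {m} t (f : Fin m → Carrier) → (if t then sumFin f else 0#) ≡ sumFin (λ i → if t then f i else 0#)
  if-distrib-sumFin     true  f = refl
  if-distrib-sumFin {m} false f = sym (sumFin-zero {m} (λ _ → 0#) (λ _ → refl))

  sumOver-sumFin-comm : ∀ {m n} (S : Subset m) (f : Fin n → Fin m → Carrier) →
                        sumOver S (λ e → sumFin (λ k → f k e)) ≡ sumFin (λ k → sumOver S (f k))
  sumOver-sumFin-comm S f = trans (sumFin-cong (λ e → if-distrib-sumFin (lookup S e) (λ k → f k e)))
                                  (sumFin-comm (λ e k → if lookup S e then f k e else 0#))

  *-distribˡ-sumOver : ∀ {m} (S : Subset m) x (f : Fin m → Carrier) → sumOver S (λ e → x * f e) ≡ x * sumOver S f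
  *-distribˡ-sumOver S x f =
    trans (sumFin-cong (λ e → if-* (lookup S e))) (*-distribˡ-sumFin x (λ e → if lookup S e then f e else 0#))
    where
    if-* : ∀ t {e} → (if t then x * f e else 0#) ≡ x * (if t then f e else 0#)
    if-* true  = refl
    if-* false = sym (zeroʳ x)

  sumOver-zero : ∀ {m} (S : Subset m) → sumOver S (λ _ → 0#) ≡ 0#
  sumOver-zero S = sumFin-zero _ (λ e → if-zero (lookup S e))
    where
    if-zero : ∀ t → (if t then 0# else 0#) ≡ 0#
    if-zero true  = refl
    if-zero false = refl

  sumFin-⊓1 : ∀ {m} {f : Fin m → Carrier} → (∀ i → 0# ≤ f i) → sumFin f ⊓ 1# ≤ sumFin (λ i → f i ⊓ 1#)
  sumFin-⊓1 {zero}      0≤f = x⊓y≤x 0# 1#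
  sumFin-⊓1 {suc m} {f} 0≤f = ≤-trans ([x+y]⊓1≤x⊓1+y⊓1 (0≤f zero) (sumFin-nonNeg (0≤f ∘ suc)))
                                      (+-monoʳ-≤ (f zero ⊓ 1#) (sumFin-⊓1 (0≤f ∘ suc)))


module FourierMotzkin (F : OrderedField) {Var : Set} (_≟_ : DecidableEquality Var) where

  open import Relation.Binary.PropositionalEquality
  open import Relation.Binary.Definitions using (tri<; tri≈; tri>)
  import Data.Nat as ℕ
  open import Data.Integer as ℤ using (ℤ; 0ℤ)
  import Data.Integer.Properties as ℤ
  open import Data.Fin.Properties using () renaming (_≟_ to _≟ᶠ_)
  open import Data.Product using (_×_; _,_; proj₁; Σ; ∃; ∃₂)
  open import Data.Sum using (_⊎_; inj₁; inj₂)
  open import Data.Bool using (true; false; if_then_else_)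
  open import Data.List using (List; []; _∷_; _++_; map; filter; cartesianProductWith)
  open import Data.List.Membership.Propositional using (_∈_; _∉_; lose)
  import Data.List.Relation.Unary.All as All
  open import Data.List.Membership.Propositional.Properties
    using (∈-map⁺; ∈-map⁻; ∈-++⁺ˡ; ∈-++⁺ʳ; ∈-++⁻; ∈-filter⁺; ∈-filter⁻; ∈-cartesianProductWith⁺; ∈-cartesianProductWith⁻)
  open import Data.List.Relation.Unary.Any using (here; there)
  open import Data.Empty using (⊥-elim)
  open import Relation.Nullary using (yes; no; does)
  open import Function using (_∘_)
  import Data.List.Extrema as Extrema

  open OrderedFieldProperties F
  open FieldSums F
  open WithField F using (sumFin)
  open Extrema totalOrder using (min; max; min≤v⁺; v≤max⁺; max≤v⁺)
  open ≡-Reasoning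

  LinearForm : Set
  LinearForm = List (ℤ × Var)

  Assignment : Set
  Assignment = Var → Carrier

  eval : LinearForm → Assignment → Carrier
  eval []            x = 0#
  eval ((c , u) ∷ ℓ) x = fromℤ c * x u + eval ℓ x

  coeff : LinearForm → Var → ℤ
  coeff []            j = 0ℤ
  coeff ((c , u) ∷ ℓ) j = (if does (u ≟ j) then c else 0ℤ) ℤ.+ coeff ℓ j

  update : Assignment → Var → Carrier → Assignment
  update x j v u = if does (u ≟ j) then v else x u

  update-≢ : ∀ x j v u → u ≢ j → update x j v u ≡ x u
  update-≢ x j v u u≢j with u ≟ j
  ... | yes u≡j = ⊥-elim (u≢j u≡j)
  ... | no _    = refl

  eval-zero : ∀ ℓ → eval ℓ (λ _ → 0#) ≡ 0#
  eval-zero []            = refl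
  eval-zero ((c , u) ∷ ℓ) = trans (cong₂ _+_ (zeroʳ (fromℤ c)) (eval-zero ℓ)) (+-identityˡ 0#)

  eval-update : ∀ ℓ x j v → eval ℓ (update x j v) ≡ eval ℓ x + fromℤ (coeff ℓ j) * (v - x j)
  eval-update [] x j v = solve 1 (λ d → con 0ℤ := con 0ℤ :+ con 0ℤ :* d) refl (v - x j)
  eval-update ((c , u) ∷ ℓ) x j v with u ≟ j
  ... | yes refl = begin
    fromℤ c * v + eval ℓ (update x u v)
      ≡⟨ cong (fromℤ c * v +_) (eval-update ℓ x u v) ⟩
    fromℤ c * v + (eval ℓ x + fromℤ (coeff ℓ u) * (v - x u))
      ≡⟨ solve 5 (λ c v xu e f → c :* v :+ (e :+ f :* (v :- xu)) := c :* xu :+ e :+ (c :+ f) :* (v :- xu))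
               refl (fromℤ c) v (x u) (eval ℓ x) (fromℤ (coeff ℓ u)) ⟩
    fromℤ c * x u + eval ℓ x + (fromℤ c + fromℤ (coeff ℓ u)) * (v - x u)
      ≡⟨ cong (λ z → fromℤ c * x u + eval ℓ x + z * (v - x u)) (sym (fromℤ-+ c (coeff ℓ u))) ⟩
    fromℤ c * x u + eval ℓ x + fromℤ (c ℤ.+ coeff ℓ u) * (v - x u) ∎
  ... | no _ = begin
    fromℤ c * x u + eval ℓ (update x j v)
      ≡⟨ cong (fromℤ c * x u +_) (eval-update ℓ x j v) ⟩
    fromℤ c * x u + (eval ℓ x + fromℤ (coeff ℓ j) * (v - x j))
      ≡⟨ solve 5 (λ c xu e f d → c :* xu :+ (e :+ f :* d) := c :* xu :+ e :+ (con 0ℤ :+ f) :* d)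
               refl (fromℤ c) (x u) (eval ℓ x) (fromℤ (coeff ℓ j)) (v - x j) ⟩
    fromℤ c * x u + eval ℓ x + (fromℤ 0ℤ + fromℤ (coeff ℓ j)) * (v - x j)
      ≡⟨ cong (λ z → fromℤ c * x u + eval ℓ x + z * (v - x j)) (sym (fromℤ-+ 0ℤ (coeff ℓ j))) ⟩
    fromℤ c * x u + eval ℓ x + fromℤ (0ℤ ℤ.+ coeff ℓ j) * (v - x j) ∎

  module System {R : ℕ} (ℓ : Fin R → LinearForm) (b : Fin R → Carrier) where

    Feasible : Assignment → Set
    Feasible x = ∀ k → eval (ℓ k) x ≤ b k

    Certificate : Set
    Certificate = Fin R → ℕ

    weighted : Certificate → (Fin R → Carrier) → Carrier
    weighted y f = sumFin (λ k → fromℕ (y k) * f k)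

    weighted-+ : ∀ y f g → weighted y (λ k → f k + g k) ≡ weighted y f + weighted y g
    weighted-+ y f g = trans (sumFin-cong (λ k → distribˡ (fromℕ (y k)) (f k) (g k)))
                             (sumFin-+ (λ k → fromℕ (y k) * f k) (λ k → fromℕ (y k) * g k))

    weighted-nonNeg : ∀ {y f} → (∀ k → 0# ≤ f k) → 0# ≤ weighted y f
    weighted-nonNeg {y} 0≤f = sumFin-nonNeg (λ k → *-nonneg (fromℕ-nonNeg (y k)) (0≤f k))

    lhs : Certificate → Assignment → Carrier
    lhs y x = weighted y (λ k → eval (ℓ k) x)

    rhs : Certificate → Carrier
    rhs y = weighted y b

    slack : Certificate → Assignment → Carrier
    slack y x = rhs y - lhs y x

    lhs-zero : ∀ y → lhs y (λ _ → 0#) ≡ 0#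
    lhs-zero y = sumFin-zero (λ k → fromℕ (y k) * eval (ℓ k) (λ _ → 0#))
                             (λ k → trans (cong (fromℕ (y k) *_) (eval-zero (ℓ k))) (zeroʳ _))

    coefficient : Certificate → Var → ℤ
    coefficient y j = sumℤ (λ k → ℤ.+ (y k) ℤ.* coeff (ℓ k) j)

    fromℤ-coefficient : ∀ y j → fromℤ (coefficient y j) ≡ weighted y (λ k → fromℤ (coeff (ℓ k) j))
    fromℤ-coefficient y j = trans (fromℤ-sumℤ (λ k → ℤ.+ (y k) ℤ.* coeff (ℓ k) j))
                                  (sumFin-cong (λ k → fromℤ-* (ℤ.+ (y k)) (coeff (ℓ k) j)))

    Satisfies : Certificate → Assignment → Set
    Satisfies y x = lhs y x ≤ rhs y

    SatisfiesAll : List Certificate → Assignment → Set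
    SatisfiesAll L x = ∀ {y} → y ∈ L → Satisfies y x

    unit : Fin R → Certificate
    unit k i = if does (k ≟ᶠ i) then 1 else 0

    weighted-unit : ∀ k f → weighted (unit k) f ≡ f k
    weighted-unit k f = trans (sumFin-cong (λ i → indicator (does (k ≟ᶠ i)) (f i))) (sumFin-indicator k f)
      where
      indicator : ∀ t v → fromℕ (if t then 1 else 0) * v ≡ (if t then v else 0#)
      indicator true  v = *-identityˡ v
      indicator false v = zeroˡ v

    satisfies-unit : ∀ {x} k → Satisfies (unit k) x → eval (ℓ k) x ≤ b k
    satisfies-unit k = subst₂ _≤_ (weighted-unit k _) (weighted-unit k b)

    lhs-update : ∀ y x j v → lhs y (update x j v) ≡ lhs y x + fromℤ (coefficient y j) * (v - x j)
    lhs-update y x j v = begin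
      weighted y (λ k → eval (ℓ k) (update x j v))
        ≡⟨ sumFin-cong (λ k → trans (cong (fromℕ (y k) *_) (eval-update (ℓ k) x j v)) (distribute (y k) k)) ⟩
      sumFin (λ k → fromℕ (y k) * eval (ℓ k) x + (v - x j) * (fromℕ (y k) * fromℤ (coeff (ℓ k) j)))
        ≡⟨ sumFin-+ (λ k → fromℕ (y k) * eval (ℓ k) x) (λ k → (v - x j) * (fromℕ (y k) * fromℤ (coeff (ℓ k) j))) ⟩
      lhs y x + sumFin (λ k → (v - x j) * (fromℕ (y k) * fromℤ (coeff (ℓ k) j)))
        ≡⟨ cong (lhs y x +_) (*-distribˡ-sumFin (v - x j) (λ k → fromℕ (y k) * fromℤ (coeff (ℓ k) j))) ⟩
      lhs y x + (v - x j) * weighted y (λ k → fromℤ (coeff (ℓ k) j))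
        ≡⟨ cong (λ z → lhs y x + z) (trans (*-comm _ _) (cong (_* (v - x j)) (sym (fromℤ-coefficient y j)))) ⟩
      lhs y x + fromℤ (coefficient y j) * (v - x j) ∎
      where
      distribute : ∀ n k → fromℕ n * (eval (ℓ k) x + fromℤ (coeff (ℓ k) j) * (v - x j))
                         ≡ fromℕ n * eval (ℓ k) x + (v - x j) * (fromℕ n * fromℤ (coeff (ℓ k) j))
      distribute n k = solve 4 (λ a e c d → a :* (e :+ c :* d) := a :* e :+ d :* (a :* c))
                             refl (fromℕ n) (eval (ℓ k) x) (fromℤ (coeff (ℓ k) j)) (v - x j)

    satisfies-update : ∀ y x j v → fromℤ (coefficient y j) * (v - x j) ≤ slack y x → Satisfies y (update x j v)
    satisfies-update y x j v step≤slack = subst₂ _≤_ (sym (lhs-update y x j v))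
      (solve 2 (λ l r → l :+ (r :- l) := r) refl (lhs y x) (rhs y)) (+-monoʳ-≤ (lhs y x) step≤slack)

    combine : ℕ → Certificate → ℕ → Certificate → Certificate
    combine α y β y′ k = α ℕ.* y k ℕ.+ β ℕ.* y′ k

    weighted-combine : ∀ α y β y′ f →
                       weighted (combine α y β y′) f ≡ fromℕ α * weighted y f + fromℕ β * weighted y′ f
    weighted-combine α y β y′ f = begin
      sumFin (λ k → fromℕ (combine α y β y′ k) * f k)
        ≡⟨ sumFin-cong (λ k → trans (cong (_* f k) (fromℕ-combine k)) (distribute k)) ⟩
      sumFin (λ k → fromℕ α * (fromℕ (y k) * f k) + fromℕ β * (fromℕ (y′ k) * f k))
        ≡⟨ sumFin-+ (λ k → fromℕ α * (fromℕ (y k) * f k)) (λ k → fromℕ β * (fromℕ (y′ k) * f k)) ⟩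
      sumFin (λ k → fromℕ α * (fromℕ (y k) * f k)) + sumFin (λ k → fromℕ β * (fromℕ (y′ k) * f k))
        ≡⟨ cong₂ _+_ (*-distribˡ-sumFin (fromℕ α) (λ k → fromℕ (y k) * f k))
                     (*-distribˡ-sumFin (fromℕ β) (λ k → fromℕ (y′ k) * f k)) ⟩
      fromℕ α * weighted y f + fromℕ β * weighted y′ f ∎
      where
      fromℕ-combine : ∀ k → fromℕ (combine α y β y′ k) ≡ fromℕ α * fromℕ (y k) + fromℕ β * fromℕ (y′ k)
      fromℕ-combine k = trans (fromℕ-+ (α ℕ.* y k) (β ℕ.* y′ k)) (cong₂ _+_ (fromℕ-* α (y k)) (fromℕ-* β (y′ k)))
      distribute : ∀ k → (fromℕ α * fromℕ (y k) + fromℕ β * fromℕ (y′ k)) * f k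
                       ≡ fromℕ α * (fromℕ (y k) * f k) + fromℕ β * (fromℕ (y′ k) * f k)
      distribute k = solve 5 (λ a u b v g → (a :* u :+ b :* v) :* g := a :* (u :* g) :+ b :* (v :* g))
                           refl (fromℕ α) (fromℕ (y k)) (fromℕ β) (fromℕ (y′ k)) (f k)

    fromℤ-coefficient-combine : ∀ α y β y′ j →
      fromℤ (coefficient (combine α y β y′) j)
        ≡ fromℕ α * fromℤ (coefficient y j) + fromℕ β * fromℤ (coefficient y′ j)
    fromℤ-coefficient-combine α y β y′ j = begin
      fromℤ (coefficient (combine α y β y′) j)
        ≡⟨ fromℤ-coefficient (combine α y β y′) j ⟩
      weighted (combine α y β y′) (λ k → fromℤ (coeff (ℓ k) j))
        ≡⟨ weighted-combine α y β y′ (λ k → fromℤ (coeff (ℓ k) j)) ⟩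
      fromℕ α * weighted y (λ k → fromℤ (coeff (ℓ k) j)) + fromℕ β * weighted y′ (λ k → fromℤ (coeff (ℓ k) j))
        ≡⟨ sym (cong₂ (λ u v → fromℕ α * u + fromℕ β * v) (fromℤ-coefficient y j) (fromℤ-coefficient y′ j)) ⟩
      fromℕ α * fromℤ (coefficient y j) + fromℕ β * fromℤ (coefficient y′ j) ∎

    Positive Negative Zero : Var → Certificate → Set
    Positive j y = 0ℤ ℤ.< coefficient y j
    Negative j y = coefficient y j ℤ.< 0ℤ
    Zero     j y = coefficient y j ≡ 0ℤ

    positive? : ∀ j y → Dec (Positive j y)
    positive? j y = 0ℤ ℤ.<? coefficient y j

    negative? : ∀ j y → Dec (Negative j y)
    negative? j y = coefficient y j ℤ.<? 0ℤ

    zero? : ∀ j y → Dec (Zero j y)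
    zero? j y = coefficient y j ℤ.≟ 0ℤ

    magnitude : Var → Certificate → Carrier
    magnitude j y = fromℕ ℤ.∣ coefficient y j ∣

    cancel : Var → Certificate → Certificate → Certificate
    cancel j y y′ = combine ℤ.∣ coefficient y′ j ∣ y ℤ.∣ coefficient y j ∣ y′

    eliminate : Var → List Certificate → List Certificate
    eliminate j L = filter (zero? j) L ++ cartesianProductWith (cancel j) (filter (positive? j) L) (filter (negative? j) L)

    zero∈eliminate : ∀ {j L y} → y ∈ L → Zero j y → y ∈ eliminate j L
    zero∈eliminate y∈L y-zero = ∈-++⁺ˡ (∈-filter⁺ (zero? _) y∈L y-zero)

    cancel∈eliminate : ∀ {j L y y′} → y ∈ L → y′ ∈ L → Positive j y → Negative j y′ →
                       cancel j y y′ ∈ eliminate j L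
    cancel∈eliminate {j} {L} y∈L y′∈L pos neg = ∈-++⁺ʳ (filter (zero? j) L)
      (∈-cartesianProductWith⁺ (cancel j) (∈-filter⁺ (positive? j) y∈L pos) (∈-filter⁺ (negative? j) y′∈L neg))

    ∈-eliminate⁻ : ∀ {j} L {y} → y ∈ eliminate j L →
                   (y ∈ L × Zero j y) ⊎
                   ∃₂ λ y₁ y₂ → y₁ ∈ L × y₂ ∈ L × Positive j y₁ × Negative j y₂ × y ≡ cancel j y₁ y₂
    ∈-eliminate⁻ {j} L y∈ with ∈-++⁻ (filter (zero? j) L) y∈
    ... | inj₁ y∈zeros = inj₁ (∈-filter⁻ (zero? j) y∈zeros)
    ... | inj₂ y∈cancels with ∈-cartesianProductWith⁻ (cancel j) (filter (positive? j) L) (filter (negative? j) L) y∈cancels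
    ... | y₁ , y₂ , y₁∈ , y₂∈ , refl with ∈-filter⁻ (positive? j) y₁∈ | ∈-filter⁻ (negative? j) y₂∈
    ... | y₁∈L , pos | y₂∈L , neg = inj₂ (y₁ , y₂ , y₁∈L , y₂∈L , pos , neg , refl)

    slack-combine : ∀ α y β y′ x → slack (combine α y β y′) x ≡ fromℕ α * slack y x + fromℕ β * slack y′ x
    slack-combine α y β y′ x = begin
      rhs (combine α y β y′) - lhs (combine α y β y′) x
        ≡⟨ cong₂ _-_ (weighted-combine α y β y′ b) (weighted-combine α y β y′ (λ k → eval (ℓ k) x)) ⟩
      (fromℕ α * rhs y + fromℕ β * rhs y′) - (fromℕ α * lhs y x + fromℕ β * lhs y′ x)
        ≡⟨ solve 6 (λ a c r r′ l l′ → (a :* r :+ c :* r′) :- (a :* l :+ c :* l′) := a :* (r :- l) :+ c :* (r′ :- l′))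
                 refl (fromℕ α) (fromℕ β) (rhs y) (rhs y′) (lhs y x) (lhs y′ x) ⟩
      fromℕ α * slack y x + fromℕ β * slack y′ x ∎

    upper lower : Var → Assignment → Certificate → Carrier
    upper j x y = magnitude j y ⁻¹ * slack y x
    lower j x y = - (magnitude j y ⁻¹ * slack y x)

    lower≤upper : ∀ {j x y y′} → Positive j y → Negative j y′ → Satisfies (cancel j y y′) x →
                  lower j x y′ ≤ upper j x y
    lower≤upper {j} {x} {y} {y′} pos neg sat =
      0≤y*r+x*s⇒-[s/y]≤r/x {magnitude j y} {magnitude j y′} {slack y x} {slack y′ x} (0<c⇒0<∣c∣ pos) (c<0⇒0<∣c∣ neg)
      (subst (0# ≤_) (slack-combine ℤ.∣ coefficient y′ j ∣ y ℤ.∣ coefficient y j ∣ y′ x) (x≤y⇒0≤y-x sat))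

    -- Each lower bound (from a negative certificate) lies below each upper bound (from a positive one),
    -- because their cancelling combination is satisfied; d is chosen in between.
    extend : ∀ j L x → SatisfiesAll (eliminate j L) x → Σ Carrier λ v → SatisfiesAll L (update x j v)
    extend j L x sat = x j + d , λ {y} y∈L → satisfies-update y x j (x j + d)
      (subst (λ z → fromℤ (coefficient y j) * z ≤ slack y x) (sym (solve 2 (λ a d → a :+ d :- a := d) refl (x j) d))
             (step y∈L))
      where
      uppers lowers : List Carrier
      uppers = map (upper j x) (filter (positive? j) L)
      lowers = map (lower j x) (filter (negative? j) L)

      d : Carrier
      d = max (min 0# uppers) lowers

      d≤upper : ∀ {y} → y ∈ L → Positive j y → d ≤ upper j x y
      d≤upper {y} y∈L pos =
        max≤v⁺ (min≤v⁺ 0# uppers (inj₂ (lose (∈-map⁺ (upper j x) (∈-filter⁺ (positive? j) y∈L pos)) ≤-refl)))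
        (All.tabulate λ l∈lowers → lower≤ (∈-map⁻ (lower j x) l∈lowers))
        where
        lower≤ : ∀ {l} → (∃ λ y′ → y′ ∈ filter (negative? j) L × l ≡ lower j x y′) → l ≤ upper j x y
        lower≤ (y′ , y′∈ , refl) with ∈-filter⁻ (negative? j) {xs = L} y′∈
        ... | y′∈L , neg = lower≤upper pos neg (sat (cancel∈eliminate y∈L y′∈L pos neg))

      lower≤d : ∀ {y} → y ∈ L → Negative j y → lower j x y ≤ d
      lower≤d y∈L neg =
        v≤max⁺ (min 0# uppers) lowers (inj₂ (lose (∈-map⁺ (lower j x) (∈-filter⁺ (negative? j) y∈L neg)) ≤-refl))

      step : ∀ {y} → y ∈ L → fromℤ (coefficient y j) * d ≤ slack y x
      step {y} y∈L with ℤ.<-cmp (coefficient y j) 0ℤ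
      ... | tri< neg _ _ = subst₂ _≤_ (-M*d≡c*d) (-‿involutive (slack y x)) (neg-antimono-≤ -slack≤M*d)
        where
        M = magnitude j y
        -slack≤M*d : - slack y x ≤ M * d
        -slack≤M*d = subst (_≤ M * d)
          (trans (sym (-‿distribʳ-* M (M ⁻¹ * slack y x))) (cong -_ (x*[x⁻¹*y]≡y (slack y x) (c<0⇒0<∣c∣ neg))))
          (*-monoʳ-≤-nonNeg M (proj₁ (c<0⇒0<∣c∣ neg)) (lower≤d y∈L neg))
        -M*d≡c*d : - (M * d) ≡ fromℤ (coefficient y j) * d
        -M*d≡c*d = trans (-‿distribˡ-* M d) (cong (_* d) (sym (fromℤ-negative neg)))
      ... | tri≈ _ y-zero _ = subst (_≤ slack y x) (trans (sym (zeroˡ d)) (cong (λ c → fromℤ c * d) (sym y-zero)))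
          (x≤y⇒0≤y-x (sat (zero∈eliminate y∈L y-zero)))
      ... | tri> _ _ pos = subst₂ _≤_ (cong (_* d) (sym (fromℤ-positive pos))) (x*[x⁻¹*y]≡y (slack y x) (0<c⇒0<∣c∣ pos))
          (*-monoʳ-≤-nonNeg (magnitude j y) (proj₁ (0<c⇒0<∣c∣ pos)) (d≤upper y∈L pos))

    eliminateAll : List Var → List Certificate → List Certificate
    eliminateAll []       L = L
    eliminateAll (j ∷ js) L = eliminateAll js (eliminate j L)

    extendAll : ∀ js L x → SatisfiesAll (eliminateAll js L) x →
                Σ Assignment λ x′ → SatisfiesAll L x′ × (∀ u → u ∉ js → x′ u ≡ x u)
    extendAll []       L x sat = x , sat , λ _ _ → refl
    extendAll (j ∷ js) L x sat =
      let x₁ , sat₁ , x₁≗x = extendAll js (eliminate j L) x sat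
          v , sat′ = extend j L x₁ sat₁
      in update x₁ j v , sat′ , λ u u∉ → trans (update-≢ x₁ j v u (u∉ ∘ here)) (x₁≗x u (u∉ ∘ there))

    Vanishes : Var → Certificate → Set
    Vanishes u y = fromℤ (coefficient y u) ≡ 0#

    eliminate-vanishes : ∀ j L {y} → y ∈ eliminate j L → Vanishes j y
    eliminate-vanishes j L y∈ with ∈-eliminate⁻ L y∈
    ... | inj₁ (_ , y-zero) = cong fromℤ y-zero
    ... | inj₂ (y₁ , y₂ , _ , _ , pos , neg , refl) = begin
      fromℤ (coefficient (cancel j y₁ y₂) j)
        ≡⟨ fromℤ-coefficient-combine ℤ.∣ coefficient y₂ j ∣ y₁ ℤ.∣ coefficient y₁ j ∣ y₂ j ⟩
      M₂ * fromℤ (coefficient y₁ j) + M₁ * fromℤ (coefficient y₂ j)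
        ≡⟨ cong₂ (λ u v → M₂ * u + M₁ * v) (fromℤ-positive pos) (fromℤ-negative neg) ⟩
      M₂ * M₁ + M₁ * - M₂
        ≡⟨ solve 2 (λ a b → a :* b :+ b :* (:- a) := con 0ℤ) refl M₂ M₁ ⟩
      0# ∎
      where
      M₁ = magnitude j y₁
      M₂ = magnitude j y₂

    eliminate-preserves-vanishes : ∀ j L u → (∀ {y} → y ∈ L → Vanishes u y) →
                                   ∀ {y} → y ∈ eliminate j L → Vanishes u y
    eliminate-preserves-vanishes j L u van y∈ with ∈-eliminate⁻ L y∈
    ... | inj₁ (y∈L , _) = van y∈L
    ... | inj₂ (y₁ , y₂ , y₁∈L , y₂∈L , _ , _ , refl) = begin
      fromℤ (coefficient (cancel j y₁ y₂) u)
        ≡⟨ fromℤ-coefficient-combine ℤ.∣ coefficient y₂ j ∣ y₁ ℤ.∣ coefficient y₁ j ∣ y₂ u ⟩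
      magnitude j y₂ * fromℤ (coefficient y₁ u) + magnitude j y₁ * fromℤ (coefficient y₂ u)
        ≡⟨ cong₂ (λ a c → magnitude j y₂ * a + magnitude j y₁ * c) (van y₁∈L) (van y₂∈L) ⟩
      magnitude j y₂ * 0# + magnitude j y₁ * 0#
        ≡⟨ solve 2 (λ a c → a :* con 0ℤ :+ c :* con 0ℤ := con 0ℤ) refl (magnitude j y₂) (magnitude j y₁) ⟩
      0# ∎

    eliminateAll-vanishes : ∀ js L {u} → u ∈ js → ∀ {y} → y ∈ eliminateAll js L → Vanishes u y
    eliminateAll-vanishes (j ∷ js) L (here refl) = preserved js (eliminate j L) (eliminate-vanishes j L)
      where
      preserved : ∀ js L → (∀ {y} → y ∈ L → Vanishes j y) → ∀ {y} → y ∈ eliminateAll js L → Vanishes j y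
      preserved []        L van = van
      preserved (j′ ∷ js) L van = preserved js (eliminate j′ L) (eliminate-preserves-vanishes j′ L j van)
    eliminateAll-vanishes (j ∷ js) L (there u∈js) = eliminateAll-vanishes js (eliminate j L) u∈js


module HCopyDecidability where

  open import Relation.Binary.PropositionalEquality
  open import Data.Nat using (zero)
  open import Data.Fin using (zero; suc)
  open import Data.Fin.Properties using (any?; all?) renaming (_≟_ to _≟ᶠ_)
  open import Data.Vec using (_∷_; lookup)
  open import Data.Bool using (true)
  open import Data.Bool.Properties using () renaming (_≟_ to _≟ᵇ_)
  open import Data.Product using (_×_; _,_; proj₁; proj₂; Σ; ∃)
  open import Relation.Nullary using (yes; no)
  open import Relation.Nullary.Decidable using (_×-dec_; _→-dec_; map′)
  open import Function using (_∘_)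
  open import Data.Vec.Functional using () renaming (_∷_ to _∷ᶠ_)
  open import Function.Definitions using (Injective)

  -- The search fixes one value at a time; P must respect pointwise equality as there is no function extensionality.
  any-function? : ∀ k {n} (P : (Fin k → Fin n) → Set) → (∀ f g → (∀ i → f i ≡ g i) → P f → P g) →
                  (∀ f → Dec (P f)) → Dec (Σ (Fin k → Fin n) P)
  any-function? zero P resp P? with P? (λ ())
  ... | yes p = yes (_ , p)
  ... | no ¬p = no λ { (f , pf) → ¬p (resp f (λ ()) (λ ()) pf) }
  any-function? (suc k) {n} P resp P?
    with any? {n = n} (λ a → any-function? k (P ∘ (a ∷ᶠ_))
                                 (λ g g′ g≗g′ → resp (a ∷ᶠ g) (a ∷ᶠ g′) (λ { zero → refl ; (suc i) → g≗g′ i }))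
                                 (P? ∘ (a ∷ᶠ_)))
  ... | yes (a , g , p) = yes (a ∷ᶠ g , p)
  ... | no ¬p = no λ { (f , pf) →
    ¬p (f zero , f ∘ suc , resp f (f zero ∷ᶠ (f ∘ suc)) (λ { zero → refl ; (suc i) → refl }) pf) }

  injective? : ∀ {k n} (f : Fin k → Fin n) → Dec (Injective _≡_ _≡_ f)
  injective? f = map′ (λ inj {x} {y} → inj x y) (λ inj x y → inj {x} {y})
                      (all? λ x → all? λ y → (f x ≟ᶠ f y) →-dec (x ≟ᶠ y))

  injective-cong : ∀ {k n} {f g : Fin k → Fin n} → (∀ i → f i ≡ g i) → Injective _≡_ _≡_ f → Injective _≡_ _≡_ g
  injective-cong {f = f} {g} f≗g inj {x} {y} gx≡gy = inj (trans (f≗g x) (trans gx≡gy (sym (f≗g y))))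

  module _ (F : OrderedField) where
    open WithField F

    isHCopy? : ∀ {k h n m} (H : Digraph k h) (D : WMultigraph n m) (S : Subset m) → Dec (IsHCopy H D S)
    isHCopy? {k} {h} {n} {m} H D S = any-function? k _ resp-φ (λ φ → any-function? h _ (resp-ψ φ) (embeds? φ))
      where
      open WMultigraph D
      Embeds : (Fin k → Fin n) → (Fin h → Fin m) → Set
      Embeds φ ψ = Injective _≡_ _≡_ φ × Injective _≡_ _≡_ ψ ×
                   (∀ a → tl (ψ a) ≡ φ (Digraph.tl H a)) ×
                   (∀ a → hd (ψ a) ≡ φ (Digraph.hd H a)) ×
                   (∀ e → (lookup S e ≡ true → ∃ λ a → ψ a ≡ e) × (∀ a → lookup S (ψ a) ≡ true))

      embeds? : ∀ φ ψ → Dec (Embeds φ ψ)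
      embeds? φ ψ = injective? φ ×-dec injective? ψ ×-dec
                    all? (λ a → tl (ψ a) ≟ᶠ φ (Digraph.tl H a)) ×-dec
                    all? (λ a → hd (ψ a) ≟ᶠ φ (Digraph.hd H a)) ×-dec
                    all? (λ e → ((lookup S e ≟ᵇ true) →-dec any? (λ a → ψ a ≟ᶠ e)) ×-dec
                                all? (λ a → lookup S (ψ a) ≟ᵇ true))

      resp-ψ : ∀ φ ψ ψ′ → (∀ a → ψ a ≡ ψ′ a) → Embeds φ ψ → Embeds φ ψ′
      resp-ψ φ ψ ψ′ ψ≗ψ′ (inj-φ , inj-ψ , tl-ψ , hd-ψ , onto) =
        inj-φ , injective-cong ψ≗ψ′ inj-ψ ,
        (λ a → trans (cong tl (sym (ψ≗ψ′ a))) (tl-ψ a)) , (λ a → trans (cong hd (sym (ψ≗ψ′ a))) (hd-ψ a)) ,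
        λ e → (λ Se → let a , ψa≡e = proj₁ (onto e) Se in a , trans (sym (ψ≗ψ′ a)) ψa≡e) ,
              (λ a → subst (λ e′ → lookup S e′ ≡ true) (ψ≗ψ′ a) (proj₂ (onto e) a))

      resp-φ : ∀ φ φ′ → (∀ v → φ v ≡ φ′ v) → Σ (Fin h → Fin m) (Embeds φ) → Σ (Fin h → Fin m) (Embeds φ′)
      resp-φ φ φ′ φ≗φ′ (ψ , inj-φ , inj-ψ , tl-ψ , hd-ψ , onto) =
        ψ , injective-cong φ≗φ′ inj-φ , inj-ψ ,
        (λ a → trans (tl-ψ a) (φ≗φ′ _)) , (λ a → trans (hd-ψ a) (φ≗φ′ _)) , onto

-- A hypergraph on the arcs Fin m whose edges are the subsets satisfying Edge; below, the H-copies of D.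
module PackingCoverDuality (F : OrderedField) {m : ℕ}
       (w : Fin m → OrderedField.Carrier F) (0≤w : ∀ e → OrderedField._≤_ F (OrderedField.0# F) (w e))
       (Edge : Subset m → Set) (edge? : ∀ S → Dec (Edge S)) where

  open import Relation.Binary.PropositionalEquality
  open import Data.Integer as ℤ using (ℤ; 0ℤ; 1ℤ; -1ℤ)
  import Data.Integer.Properties as ℤ
  open import Data.Fin.Properties using () renaming (_≟_ to _≟ᶠ_)
  open import Data.Vec using ([]; _∷_; lookup)
  open import Data.Bool using (Bool; true; false; if_then_else_)
  open import Data.List as List using (List; []; _∷_; _++_; map; filter; allFin)
  open import Data.List.Membership.Propositional using (_∈_; _∉_; lose)
  open import Data.List.Membership.Propositional.Properties
    using (∈-map⁺; ∈-map⁻; ∈-++⁺ˡ; ∈-++⁺ʳ; ∈-allFin; ∈-filter⁺; ∈-filter⁻)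
  import Data.List.Relation.Unary.All as All
  import Data.List.Extrema as Extrema
  open import Data.List.Relation.Unary.Any using (here; index)
  open import Data.List.Relation.Unary.Any.Properties using (lookup-index)
  open import Data.Maybe using (Maybe; just; nothing)
  import Data.Maybe.Properties as Maybe
  open import Data.Product using (_×_; _,_; proj₁; proj₂; Σ; ∃)
  open import Data.Empty using (⊥-elim)
  open import Relation.Nullary using (¬_; yes; no; does)
  open import Function using (_∘_; id)
  open import Data.Sum using (_⊎_; inj₁; inj₂)

  open Subsets
  open OrderedFieldProperties F
  open FieldSums F
  open WithField F using (sumFin; sumOver; packingValue)
  open Extrema totalOrder using (min; argmin-sel; min≤v⁺; v≤min⁺)

  subsets : List (Subset m)
  subsets = allSubsets m

  IsPacking : (Subset m → Carrier) → Set
  IsPacking p = (∀ S → 0# ≤ p S) × (∀ S → ¬ Edge S → p S ≡ 0#) ×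
                (∀ e → ΣL (allSubsets m) (λ S → if lookup S e then p S else 0#) ≤ w e)

  IsCover : (Fin m → Carrier) → Set
  IsCover c = (∀ e → 0# ≤ c e) × (∀ S → Edge S → 1# ≤ sumOver S c)

  value : (Fin m → Carrier) → Carrier
  value c = sumFin (λ e → w e * c e)

  weak-duality : ∀ {p c} → IsPacking p → IsCover c → packingValue p ≤ value c
  weak-duality {p} {c} (0≤p , p-nonEdge , p-capacity) (0≤c , c-covers) = begin
    ΣL subsets p
      ≤⟨ ΣL-mono-≤ subsets p≤load ⟩
    ΣL subsets (λ S → p S * sumOver S c)
      ≡⟨ ΣL-cong subsets (λ S → sym (*-distribˡ-sumFin (p S) (λ e → if lookup S e then c e else 0#))) ⟩
    ΣL subsets (λ S → sumFin (λ e → p S * (if lookup S e then c e else 0#)))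
      ≡⟨ ΣL-sumFin-comm subsets (λ S e → p S * (if lookup S e then c e else 0#)) ⟩
    sumFin (λ e → ΣL subsets (λ S → p S * (if lookup S e then c e else 0#)))
      ≡⟨ sumFin-cong (λ e → trans (ΣL-cong subsets (λ S → swap (lookup S e) (p S) (c e)))
                                  (*-distribˡ-ΣL subsets (c e) (λ S → if lookup S e then p S else 0#))) ⟩
    sumFin (λ e → c e * ΣL subsets (λ S → if lookup S e then p S else 0#))
      ≤⟨ sumFin-mono-≤ (λ e → *-monoʳ-≤-nonNeg (c e) (0≤c e) (p-capacity e)) ⟩
    sumFin (λ e → c e * w e)
      ≡⟨ sumFin-cong (λ e → *-comm (c e) (w e)) ⟩
    value c ∎
    where
    open ≤-Reasoning
    swap : ∀ t x v → x * (if t then v else 0#) ≡ v * (if t then x else 0#)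
    swap true  x v = *-comm x v
    swap false x v = trans (zeroʳ x) (sym (zeroʳ v))
    p≤load : ∀ S → p S ≤ p S * sumOver S c
    p≤load S with edge? S
    ... | yes edge = subst (_≤ p S * sumOver S c) (*-identityʳ (p S)) (*-monoʳ-≤-nonNeg (p S) (0≤p S) (c-covers S edge))
    ... | no ¬edge = begin
      p S                ≡⟨ p-nonEdge S ¬edge ⟩
      0#                 ≡⟨ sym (zeroˡ (sumOver S c)) ⟩
      0# * sumOver S c   ≡⟨ cong (_* sumOver S c) (sym (p-nonEdge S ¬edge)) ⟩
      p S * sumOver S c  ∎

  -- The packing LP: a variable p S for every subset S, and nothing for the packing value t.
  Var : Set
  Var = Maybe (Subset m)

  open FourierMotzkin F {Var} (Maybe.≡-dec _≟ˢ_)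

  data Row : Set where
    capacity : Fin m → Row
    nonNeg nonEdge : Subset m → Row
    packingValue≤ : Row

  rows : List Row
  rows = map capacity (allFin m) ++ map nonNeg subsets ++ map nonEdge subsets ++ packingValue≤ ∷ []

  ∈-rows : ∀ r → r ∈ rows
  ∈-rows (capacity e)  = ∈-++⁺ˡ (∈-map⁺ capacity (∈-allFin e))
  ∈-rows (nonNeg S)    = ∈-++⁺ʳ (map capacity (allFin m)) (∈-++⁺ˡ (∈-map⁺ nonNeg (∈-allSubsets S)))
  ∈-rows (nonEdge S)   = ∈-++⁺ʳ (map capacity (allFin m))
                           (∈-++⁺ʳ (map nonNeg subsets) (∈-++⁺ˡ (∈-map⁺ nonEdge (∈-allSubsets S))))
  ∈-rows packingValue≤ = ∈-++⁺ʳ (map capacity (allFin m))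
                           (∈-++⁺ʳ (map nonNeg subsets) (∈-++⁺ʳ (map nonEdge subsets) (here refl)))

  indicatorℤ : Bool → ℤ
  indicatorℤ t = if t then 1ℤ else 0ℤ

  form : Row → LinearForm
  form (capacity e)  = map (λ S → indicatorℤ (lookup S e) , just S) subsets
  form (nonNeg S)    = (-1ℤ , just S) ∷ []
  form (nonEdge S)   = ((if does (edge? S) then 0ℤ else 1ℤ) , just S) ∷ []
  form packingValue≤ = (1ℤ , nothing) ∷ map (λ S → -1ℤ , just S) subsets

  bound : Row → Carrier
  bound (capacity e) = w e
  bound _            = 0#

  bound-nonNeg : ∀ r → 0# ≤ bound r
  bound-nonNeg (capacity e) = 0≤w e
  bound-nonNeg (nonNeg _)   = ≤-refl
  bound-nonNeg (nonEdge _)  = ≤-refl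
  bound-nonNeg packingValue≤ = ≤-refl

  R : ℕ
  R = List.length rows

  row : Fin R → Row
  row = List.lookup rows

  open System (form ∘ row) (bound ∘ row)

  feasible⇒row : ∀ {x} → Feasible x → ∀ r → eval (form r) x ≤ bound r
  feasible⇒row {x} feasible r =
    subst (λ r′ → eval (form r′) x ≤ bound r′) (sym (lookup-index (∈-rows r))) (feasible (index (∈-rows r)))

  packingOf : Assignment → Subset m → Carrier
  packingOf x S = x (just S)

  eval-map : ∀ (Ss : List (Subset m)) (c : Subset m → ℤ) x →
             eval (map (λ S → c S , just S) Ss) x ≡ ΣL Ss (λ S → fromℤ (c S) * packingOf x S)
  eval-map []       c x = refl
  eval-map (S ∷ Ss) c x = cong (fromℤ (c S) * x (just S) +_) (eval-map Ss c x)

  feasible⇒isPacking : ∀ {x} → Feasible x → IsPacking (packingOf x)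
  feasible⇒isPacking {x} feasible = 0≤p , p-nonEdge , p-capacity
    where
    0≤p : ∀ S → 0# ≤ x (just S)
    0≤p S = subst (0# ≤_) (-‿involutive _)
      (x≤0⇒0≤-x (subst (_≤ 0#) (trans (+-identityʳ _) (-1*x≡-x _)) (feasible⇒row feasible (nonNeg S))))
    p-nonEdge : ∀ S → ¬ Edge S → x (just S) ≡ 0#
    p-nonEdge S ¬edge with edge? S | feasible⇒row feasible (nonEdge S)
    ... | yes edge | _  = ⊥-elim (¬edge edge)
    ... | no _     | p≤0 = antisym (subst (_≤ 0#) (trans (+-identityʳ _) (*-identityˡ _)) p≤0) (0≤p S)
    p-capacity : ∀ e → ΣL subsets (λ S → if lookup S e then x (just S) else 0#) ≤ w e
    p-capacity e = subst (_≤ w e)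
      (trans (eval-map subsets (λ S → indicatorℤ (lookup S e)) x) (ΣL-cong subsets (λ S → indicator (lookup S e) _)))
      (feasible⇒row feasible (capacity e))
      where
      indicator : ∀ t v → fromℤ (indicatorℤ t) * v ≡ (if t then v else 0#)
      indicator true  v = *-identityˡ v
      indicator false v = zeroˡ v

  feasible⇒value≤packingValue : ∀ {x} → Feasible x → x nothing ≤ packingValue (packingOf x)
  feasible⇒value≤packingValue {x} feasible =
    0≤y-x⇒x≤y (subst (0# ≤_) rearranged (x≤0⇒0≤-x (feasible⇒row feasible packingValue≤)))
    where
    open ≡-Reasoning
    rearranged : - eval (form packingValue≤) x ≡ packingValue (packingOf x) - x nothing
    rearranged = begin
      - (fromℤ 1ℤ * x nothing + eval (map (λ S → -1ℤ , just S) subsets) x)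
        ≡⟨ cong (λ z → - (fromℤ 1ℤ * x nothing + z))
                (trans (eval-map subsets (λ _ → -1ℤ) x)
                       (trans (ΣL-cong subsets (λ S → -1*x≡-x _)) (ΣL-neg subsets (packingOf x)))) ⟩
      - (fromℤ 1ℤ * x nothing + - ΣL subsets (packingOf x))
        ≡⟨ solve 2 (λ t P → :- (con 1ℤ :* t :+ (:- P)) := P :- t) refl (x nothing) (ΣL subsets (packingOf x)) ⟩
      packingValue (packingOf x) - x nothing ∎

  indicatorᶜ : Bool → Carrier
  indicatorᶜ t = if t then 1# else 0#

  capacityWeight : Row → Fin m → Carrier
  capacityWeight (capacity e′) e = indicatorᶜ (does (e′ ≟ᶠ e))
  capacityWeight _             e = 0#

  nonNegWeight : Row → Subset m → Carrier
  nonNegWeight (nonNeg S′) S = indicatorᶜ (does (S′ ≟ˢ S))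
  nonNegWeight _           S = 0#

  valueWeight : Row → Carrier
  valueWeight packingValue≤ = 1#
  valueWeight _             = 0#

  indicatorᶜ-nonNeg : ∀ t → 0# ≤ indicatorᶜ t
  indicatorᶜ-nonNeg true  = 0≤1
  indicatorᶜ-nonNeg false = ≤-refl

  capacityWeight-nonNeg : ∀ r e → 0# ≤ capacityWeight r e
  capacityWeight-nonNeg (capacity e′)  e = indicatorᶜ-nonNeg (does (e′ ≟ᶠ e))
  capacityWeight-nonNeg (nonNeg _)     e = ≤-refl
  capacityWeight-nonNeg (nonEdge _)    e = ≤-refl
  capacityWeight-nonNeg packingValue≤  e = ≤-refl

  nonNegWeight-nonNeg : ∀ r S → 0# ≤ nonNegWeight r S
  nonNegWeight-nonNeg (capacity _)  S = ≤-refl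
  nonNegWeight-nonNeg (nonNeg S′)   S = indicatorᶜ-nonNeg (does (S′ ≟ˢ S))
  nonNegWeight-nonNeg (nonEdge _)   S = ≤-refl
  nonNegWeight-nonNeg packingValue≤ S = ≤-refl

  fromℤ-indicatorℤ : ∀ t → fromℤ (indicatorℤ t) ≡ indicatorᶜ t
  fromℤ-indicatorℤ true  = refl
  fromℤ-indicatorℤ false = refl

  coeff-map-nothing : ∀ (Ss : List (Subset m)) (c : Subset m → ℤ) → coeff (map (λ S → c S , just S) Ss) nothing ≡ 0ℤ
  coeff-map-nothing []       c = refl
  coeff-map-nothing (S ∷ Ss) c = trans (ℤ.+-identityˡ _) (coeff-map-nothing Ss c)

  coeff-map-just : ∀ (Ss : List (Subset m)) (c : Subset m → ℤ) S →
                   fromℤ (coeff (map (λ S′ → c S′ , just S′) Ss) (just S))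
                     ≡ ΣL Ss (λ S′ → if does (S′ ≟ˢ S) then fromℤ (c S′) else 0#)
  coeff-map-just []        c S = refl
  coeff-map-just (S′ ∷ Ss) c S =
    trans (fromℤ-+ (if does (S′ ≟ˢ S) then c S′ else 0ℤ) (coeff (map (λ S″ → c S″ , just S″) Ss) (just S)))
      (cong₂ _+_ (fromℤ-if (does (S′ ≟ˢ S))) (coeff-map-just Ss c S))
    where
    fromℤ-if : ∀ t → fromℤ (if t then c S′ else 0ℤ) ≡ (if t then fromℤ (c S′) else 0#)
    fromℤ-if true  = refl
    fromℤ-if false = refl

  coeff-subsets : ∀ (c : Subset m → ℤ) S → fromℤ (coeff (map (λ S′ → c S′ , just S′) subsets) (just S)) ≡ fromℤ (c S)
  coeff-subsets c S = trans (coeff-map-just subsets c S) (ΣL-allSubsets-indicator S (fromℤ ∘ c))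

  sumOver-capacityWeight : ∀ e S → sumOver S (capacityWeight (capacity e)) ≡ indicatorᶜ (lookup S e)
  sumOver-capacityWeight e S =
    trans (sumFin-cong (λ e′ → if-swap (does (e ≟ᶠ e′)) (lookup S e′))) (sumFin-indicator e (λ e′ → indicatorᶜ (lookup S e′)))
    where
    if-swap : ∀ s t → (if t then indicatorᶜ s else 0#) ≡ (if s then indicatorᶜ t else 0#)
    if-swap true  true  = refl
    if-swap true  false = refl
    if-swap false true  = refl
    if-swap false false = refl

  coeff-value : ∀ r → fromℤ (coeff (form r) nothing) ≡ valueWeight r
  coeff-value (capacity e)  = cong fromℤ (coeff-map-nothing subsets (λ S → indicatorℤ (lookup S e)))
  coeff-value (nonNeg _)    = refl
  coeff-value (nonEdge _)   = refl
  coeff-value packingValue≤ = cong (λ c → fromℤ (1ℤ ℤ.+ c)) (coeff-map-nothing subsets (λ _ → -1ℤ))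

  coeff-edge : ∀ r {S} → Edge S →
               fromℤ (coeff (form r) (just S)) + (nonNegWeight r S + valueWeight r) ≡ sumOver S (capacityWeight r)
  coeff-edge (capacity e) {S} _ = begin
    fromℤ (coeff (form (capacity e)) (just S)) + (0# + 0#)
      ≡⟨ cong₂ _+_ (coeff-subsets (λ S′ → indicatorℤ (lookup S′ e)) S) (+-identityˡ 0#) ⟩
    fromℤ (indicatorℤ (lookup S e)) + 0#
      ≡⟨ trans (+-identityʳ _) (fromℤ-indicatorℤ (lookup S e)) ⟩
    indicatorᶜ (lookup S e)
      ≡⟨ sym (sumOver-capacityWeight e S) ⟩
    sumOver S (capacityWeight (capacity e)) ∎
    where open ≡-Reasoning
  coeff-edge (nonNeg S′) {S} _ = trans (cancels (does (S′ ≟ˢ S))) (sym (sumOver-zero S))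
    where
    cancels : ∀ t → fromℤ ((if t then -1ℤ else 0ℤ) ℤ.+ 0ℤ) + (indicatorᶜ t + 0#) ≡ 0#
    cancels true  = solve 0 (con (-1ℤ ℤ.+ 0ℤ) :+ (con 1ℤ :+ con 0ℤ) := con 0ℤ) refl
    cancels false = solve 0 (con (0ℤ ℤ.+ 0ℤ) :+ (con 0ℤ :+ con 0ℤ) := con 0ℤ) refl
  coeff-edge (nonEdge S′) {S} edge with S′ ≟ˢ S
  ... | no _ = trans (solve 0 (con (0ℤ ℤ.+ 0ℤ) :+ (con 0ℤ :+ con 0ℤ) := con 0ℤ) refl) (sym (sumOver-zero S))
  ... | yes refl with edge? S
  ...   | yes _     = trans (solve 0 (con (0ℤ ℤ.+ 0ℤ) :+ (con 0ℤ :+ con 0ℤ) := con 0ℤ) refl) (sym (sumOver-zero S))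
  ...   | no ¬edge  = ⊥-elim (¬edge edge)
  coeff-edge packingValue≤ {S} _ = begin
    fromℤ (0ℤ ℤ.+ coeff (map (λ S′ → -1ℤ , just S′) subsets) (just S)) + (0# + 1#)
      ≡⟨ cong (λ c → fromℤ c + (0# + 1#)) (ℤ.+-identityˡ (coeff (map (λ S′ → -1ℤ , just S′) subsets) (just S))) ⟩
    fromℤ (coeff (map (λ S′ → -1ℤ , just S′) subsets) (just S)) + (0# + 1#)
      ≡⟨ cong (_+ (0# + 1#)) (coeff-subsets (λ _ → -1ℤ) S) ⟩
    fromℤ -1ℤ + (0# + 1#)
      ≡⟨ solve 0 (con -1ℤ :+ (con 0ℤ :+ con 1ℤ) := con 0ℤ) refl ⟩
    0#
      ≡⟨ sym (sumOver-zero S) ⟩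
    sumOver S (λ _ → 0#) ∎
    where open ≡-Reasoning

  bound≡value : ∀ r → bound r ≡ value (capacityWeight r)
  bound≡value (capacity e) = sym (trans (sumFin-cong (λ e′ → w*indicator (does (e ≟ᶠ e′)) (w e′))) (sumFin-indicator e w))
    where
    w*indicator : ∀ t v → v * indicatorᶜ t ≡ (if t then v else 0#)
    w*indicator true  v = *-identityʳ v
    w*indicator false v = zeroʳ v
  bound≡value (nonNeg _)    = sym (sumFin-zero (λ e → w e * 0#) (λ e → zeroʳ (w e)))
  bound≡value (nonEdge _)   = sym (sumFin-zero (λ e → w e * 0#) (λ e → zeroʳ (w e)))
  bound≡value packingValue≤ = sym (sumFin-zero (λ e → w e * 0#) (λ e → zeroʳ (w e)))

  -- A certificate in which every p S cancels and t has coefficient M > 0 is a dual solution: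
  -- its weights on the capacity rows, divided by M, form a cover of value rhs y / M.
  module CertificateCover (y : Certificate) (t-pos : Positive nothing y) (p-vanish : ∀ S → Vanishes (just S) y) where

    M : Carrier
    M = magnitude nothing y

    0<M : 0# < M
    0<M = 0<c⇒0<∣c∣ t-pos

    load : Fin m → Carrier
    load e = weighted y (λ k → capacityWeight (row k) e)

    cover : Fin m → Carrier
    cover e = M ⁻¹ * load e

    M≡ : M ≡ weighted y (valueWeight ∘ row)
    M≡ = trans (sym (fromℤ-positive t-pos))
               (trans (fromℤ-coefficient y nothing) (sumFin-cong (λ k → cong (fromℕ (y k) *_) (coeff-value (row k)))))

    sumOver-load : ∀ S → sumOver S load ≡ weighted y (λ k → sumOver S (capacityWeight (row k)))
    sumOver-load S = trans (sumOver-sumFin-comm S (λ k e → fromℕ (y k) * capacityWeight (row k) e))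
                           (sumFin-cong (λ k → *-distribˡ-sumOver S (fromℕ (y k)) (capacityWeight (row k))))

    M≤load : ∀ {S} → Edge S → M ≤ sumOver S load
    M≤load {S} edge = begin
      M
        ≡⟨ sym (+-identityˡ M) ⟩
      0# + M
        ≤⟨ +-monoˡ-≤ M (weighted-nonNeg {y} (λ k → nonNegWeight-nonNeg (row k) S)) ⟩
      weighted y nn + M
        ≡⟨ sym (+-identityˡ _) ⟩
      0# + (weighted y nn + M)
        ≡⟨ cong₂ _+_ (trans (sym (p-vanish S)) (fromℤ-coefficient y (just S))) (cong (weighted y nn +_) M≡) ⟩
      weighted y cf + (weighted y nn + weighted y vw)
        ≡⟨ sym (trans (weighted-+ y cf _) (cong (weighted y cf +_) (weighted-+ y nn vw))) ⟩
      weighted y (λ k → cf k + (nn k + vw k))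
        ≡⟨ sumFin-cong (λ k → cong (fromℕ (y k) *_) (pointwise k)) ⟩
      weighted y (λ k → sumOver S (capacityWeight (row k)))
        ≡⟨ sym (sumOver-load S) ⟩
      sumOver S load ∎
      where
      open ≤-Reasoning
      cf nn vw : Fin R → Carrier
      cf k = fromℤ (coeff (form (row k)) (just S))
      nn k = nonNegWeight (row k) S
      vw k = valueWeight (row k)
      pointwise : ∀ k → cf k + (nn k + vw k) ≡ sumOver S (capacityWeight (row k))
      pointwise k = coeff-edge (row k) edge

    cover-isCover : IsCover cover
    cover-isCover = (λ e → *-nonneg (⁻¹-nonNeg 0<M) (weighted-nonNeg {y} (λ k → capacityWeight-nonNeg (row k) e))) ,
                    λ S edge → subst₂ _≤_ (x⁻¹*x≡1 0<M) (sym (*-distribˡ-sumOver S (M ⁻¹) load))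
                                      (*-monoʳ-≤-nonNeg (M ⁻¹) (⁻¹-nonNeg 0<M) (M≤load edge))

    value-cover : value cover ≡ M ⁻¹ * rhs y
    value-cover = begin
      sumFin (λ e → w e * (M ⁻¹ * load e))
        ≡⟨ sumFin-cong (λ e → solve 3 (λ a i l → a :* (i :* l) := i :* (a :* l)) refl (w e) (M ⁻¹) (load e)) ⟩
      sumFin (λ e → M ⁻¹ * (w e * load e))
        ≡⟨ *-distribˡ-sumFin (M ⁻¹) (λ e → w e * load e) ⟩
      M ⁻¹ * sumFin (λ e → w e * load e)
        ≡⟨ cong (M ⁻¹ *_) value-load ⟩
      M ⁻¹ * rhs y ∎
      where
      open ≡-Reasoning
      value-load : sumFin (λ e → w e * load e) ≡ rhs y
      value-load = begin
        sumFin (λ e → w e * load e)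
          ≡⟨ sumFin-cong (λ e → trans (sym (*-distribˡ-sumFin (w e) (λ k → fromℕ (y k) * capacityWeight (row k) e)))
                                     (sumFin-cong (λ k → solve 3 (λ a u v → a :* (u :* v) := u :* (a :* v))
                                                                refl (w e) (fromℕ (y k)) (capacityWeight (row k) e)))) ⟩
        sumFin (λ e → sumFin (λ k → fromℕ (y k) * (w e * capacityWeight (row k) e)))
          ≡⟨ sumFin-comm (λ e k → fromℕ (y k) * (w e * capacityWeight (row k) e)) ⟩
        sumFin (λ k → sumFin (λ e → fromℕ (y k) * (w e * capacityWeight (row k) e)))
          ≡⟨ sumFin-cong (λ k → trans (*-distribˡ-sumFin (fromℕ (y k)) (λ e → w e * capacityWeight (row k) e))
                                     (cong (fromℕ (y k) *_) (sym (bound≡value (row k))))) ⟩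
        rhs y ∎

  -- Eliminating every p S leaves inequalities in the packing value t alone; t* is the least upper bound
  -- they impose, capped by W, which exceeds every packing value when no edge is empty.
  certificates : List Certificate
  certificates = eliminateAll (map just subsets) (map unit (allFin R))

  bounded : List Certificate
  bounded = filter (positive? nothing) certificates

  tBound : Certificate → Carrier
  tBound y = magnitude nothing y ⁻¹ * rhs y

  W : Carrier
  W = sumFin w + 1#

  t* : Carrier
  t* = min W (map tBound bounded)

  0≤t* : 0# ≤ t*
  0≤t* = v≤min⁺ (subst (_≤ W) (+-identityˡ 0#) (+-mono-≤ (sumFin-nonNeg 0≤w) 0≤1)) (All.tabulate 0≤tBound)
    where
    0≤tBound : ∀ {b} → b ∈ map tBound bounded → 0# ≤ b
    0≤tBound b∈ =
      let y , y∈ , b≡tBound = ∈-map⁻ tBound b∈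
          pos = proj₂ (∈-filter⁻ (positive? nothing) {xs = certificates} y∈)
      in subst (0# ≤_) (sym b≡tBound) (*-nonneg (⁻¹-nonNeg (0<c⇒0<∣c∣ pos)) (weighted-nonNeg {y} (bound-nonNeg ∘ row)))

  t*-satisfies : SatisfiesAll certificates (update (λ _ → 0#) nothing t*)
  t*-satisfies {y} y∈ = satisfies-update y (λ _ → 0#) nothing t*
    (subst₂ _≤_ (cong (fromℤ (coefficient y nothing) *_) t*≡t*-0) rhs≡slack (coefficient*t*≤rhs (positive? nothing y)))
    where
    t*≡t*-0 : t* ≡ t* - 0#
    t*≡t*-0 = solve 1 (λ t → t := t :- con 0ℤ) refl t*
    rhs≡slack : rhs y ≡ slack y (λ _ → 0#)
    rhs≡slack = trans (solve 1 (λ r → r := r :- con 0ℤ) refl (rhs y)) (cong (λ l → rhs y - l) (sym (lhs-zero y)))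
    coefficient*t*≤rhs : Dec (Positive nothing y) → fromℤ (coefficient y nothing) * t* ≤ rhs y
    coefficient*t*≤rhs (yes pos) =
      subst₂ _≤_ (cong (_* t*) (sym (fromℤ-positive pos))) (x*[x⁻¹*y]≡y (rhs y) (0<c⇒0<∣c∣ pos))
        (*-monoʳ-≤-nonNeg _ (proj₁ (0<c⇒0<∣c∣ pos))
           (min≤v⁺ W (map tBound bounded) (inj₂ (lose (∈-map⁺ tBound (∈-filter⁺ (positive? nothing) y∈ pos)) ≤-refl))))
    coefficient*t*≤rhs (no ¬pos) =
      ≤-trans (x≤0⇒x*y≤0 (fromℤ-nonPositive ¬pos) 0≤t*) (weighted-nonNeg {y} (bound-nonNeg ∘ row))

  t*≤packing : Σ (Subset m → Carrier) λ p → IsPacking p × t* ≤ packingValue p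
  t*≤packing =
    let x′ , x′-satisfies , x′≗ =
          extendAll (map just subsets) (map unit (allFin R)) (update (λ _ → 0#) nothing t*) t*-satisfies
        feasible : Feasible x′
        feasible k = satisfies-unit k (x′-satisfies (∈-map⁺ unit (∈-allFin k)))
    in packingOf x′ , feasible⇒isPacking feasible ,
       subst (_≤ packingValue (packingOf x′)) (x′≗ nothing nothing∉) (feasible⇒value≤packingValue feasible)
    where
    nothing∉ : nothing ∉ map just subsets
    nothing∉ nothing∈ with ∈-map⁻ just nothing∈
    ... | _ , _ , ()

  tBound-cover : ∀ {y} → y ∈ bounded → Σ (Fin m → Carrier) λ c → IsCover c × value c ≡ tBound y
  tBound-cover {y} y∈ = cover , cover-isCover , value-cover
    where
    y∈certificates = proj₁ (∈-filter⁻ (positive? nothing) {xs = certificates} y∈)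
    open CertificateCover y (proj₂ (∈-filter⁻ (positive? nothing) {xs = certificates} y∈))
      (λ S → eliminateAll-vanishes (map just subsets) (map unit (allFin R)) (∈-map⁺ just (∈-allSubsets {m} S)) y∈certificates)

  module _ (edge-nonEmpty : ∀ S → Edge S → ∃ λ e → lookup S e ≡ true) where

    ones-isCover : IsCover (λ _ → 1#)
    ones-isCover = (λ _ → 0≤1) , λ S edge →
      let e , Se≡true = edge-nonEmpty S edge in
      subst (_≤ sumOver S (λ _ → 1#)) (cong indicatorᶜ Se≡true)
            (term≤sumFin (λ e′ → indicatorᶜ-nonNeg (lookup S e′)) e)

    packingValue≤totalWeight : ∀ {p} → IsPacking p → packingValue p ≤ sumFin w
    packingValue≤totalWeight {p} isPacking =
      subst (packingValue p ≤_) (sumFin-cong (λ e → *-identityʳ (w e))) (weak-duality isPacking ones-isCover)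

    strong-duality : Σ (Subset m → Carrier) λ p → IsPacking p ×
                     Σ (Fin m → Carrier) λ c → IsCover c × value c ≤ packingValue p
    strong-duality = from t*≤packing (argmin-sel id W (map tBound bounded))
      where
      from : (Σ (Subset m → Carrier) λ p → IsPacking p × t* ≤ packingValue p) → (t* ≡ W) ⊎ (t* ∈ map tBound bounded) →
             Σ (Subset m → Carrier) λ p → IsPacking p × Σ (Fin m → Carrier) λ c → IsCover c × value c ≤ packingValue p
      from (p , isPacking , t*≤p) (inj₁ t*≡W) =
        ⊥-elim (x+1≰x (≤-trans (subst (_≤ packingValue p) t*≡W t*≤p) (packingValue≤totalWeight isPacking)))
      from (p , isPacking , t*≤p) (inj₂ t*∈) =
        let y , y∈ , t*≡tBound = ∈-map⁻ tBound t*∈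
            c , isCover , value≡ = tBound-cover y∈
        in p , isPacking , c , isCover , subst (_≤ packingValue p) (trans t*≡tBound (sym value≡)) t*≤p


module HCopyCovers (F : OrderedField) {k h n m} (H : Digraph k h) (D : WithField.WMultigraph F n m) where

  open import Relation.Binary.PropositionalEquality
  open import Data.Fin.Properties using (any?)
  open import Data.Vec using (lookup; replicate)
  open import Data.Vec.Properties using (lookup-replicate)
  open import Data.Bool using (true; false; if_then_else_)
  open import Data.Bool.Properties using () renaming (_≟_ to _≟ᵇ_)
  open import Data.List using (List; map; filter)
  open import Data.List.Membership.Propositional using (_∈_; lose)
  open import Data.List.Membership.Propositional.Properties using (∈-map⁺; ∈-map⁻; ∈-filter⁺; ∈-filter⁻)
  import Data.List.Relation.Unary.All as All
  import Data.List.Extrema as Extrema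
  open import Data.Product using (_×_; _,_; proj₁; proj₂; Σ; ∃)
  open import Data.Sum using (_⊎_; inj₁; inj₂)
  open import Relation.Nullary.Decidable using (_×-dec_; _→-dec_; map′)
  open import Function using (_∘_; id)
  open Subsets
  open HCopyDecidability

  open OrderedFieldProperties F
  open FieldSums F
  open WithField F
  open WMultigraph D
  open PackingCoverDuality F w w≥0 (IsHCopy H D) (isHCopy? F H D) public
  open Extrema totalOrder using (min; argmin-sel; min≤v⁺)

  fracCover⇒cover : ∀ {c} → IsFracCover H D c → IsCover c
  fracCover⇒cover (bounds , covers) = proj₁ ∘ bounds , covers

  -- Truncating a cover at 1 keeps it a cover: an H-copy either meets an arc of weight ≥ 1 or keeps its sum.
  cover⇒truncated-fracCover : ∀ {c} → IsCover c → IsFracCover H D (λ e → c e ⊓ 1#)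
  cover⇒truncated-fracCover {c} (0≤c , covers) = (λ e → x⊓1-nonNeg (0≤c e) , x⊓y≤y (c e) 1#) , λ S copy →
    ≤-trans (⊓-glb (covers S copy) ≤-refl)
            (≤-trans (sumFin-⊓1 (λ e → if-nonNeg (lookup S e) (0≤c e))) (sumFin-mono-≤ (λ e → truncate-if (lookup S e))))
    where
    if-nonNeg : ∀ t {v} → 0# ≤ v → 0# ≤ (if t then v else 0#)
    if-nonNeg true  0≤v = 0≤v
    if-nonNeg false _   = ≤-refl
    truncate-if : ∀ t {e} → (if t then c e else 0#) ⊓ 1# ≤ (if t then c e ⊓ 1# else 0#)
    truncate-if true  = ≤-refl
    truncate-if false = x⊓y≤x 0# 1#

  coverValue-truncate : ∀ c → coverValue D (λ e → c e ⊓ 1#) ≤ coverValue D c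
  coverValue-truncate c = sumFin-mono-≤ (λ e → *-monoʳ-≤-nonNeg (w e) (w≥0 e) (x⊓y≤x (c e) 1#))

  nuStar≤value : ∀ {N c} → IsNuStar H D N → IsCover c → N ≤ value c
  nuStar≤value ((p , isPacking , refl) , _) isCover = weak-duality isPacking isCover

  transversal? : ∀ T → Dec (IsHTransversal H D T)
  transversal? T = map′ (λ all S copy → All.lookup all (∈-allSubsets S) copy) (λ tr → All.tabulate (λ {S} _ → tr S))
    (All.all? (λ S → isHCopy? F H D S →-dec any? (λ e → (lookup S e ≟ᵇ true) ×-dec (lookup T e ≟ᵇ true))) (allSubsets m))

  -- An arc a of H makes every H-copy non-empty.
  module _ (a : Fin h) where

    copy-nonEmpty : ∀ S → IsHCopy H D S → ∃ λ e → lookup S e ≡ true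
    copy-nonEmpty S (_ , ψ , _ , _ , _ , _ , onto) = ψ a , proj₂ (onto (ψ a)) a

    nuStar-exists : Σ Carrier (IsNuStar H D)
    nuStar-exists =
      let p , isPacking , c , isCover , value≤ = strong-duality copy-nonEmpty
      in packingValue p , (p , isPacking , refl) , λ q isPacking′ → ≤-trans (weak-duality isPacking′ isCover) value≤

    minFracCover≤nuStar : ∀ {c N} → IsMinFracCover H D c → IsNuStar H D N → coverValue D c ≤ N
    minFracCover≤nuStar {c} {N} (_ , minimal) (_ , N-max) =
      let p , isPacking , c′ , isCover , value≤ = strong-duality copy-nonEmpty
      in ≤-trans (minimal _ (cover⇒truncated-fracCover isCover))
                 (≤-trans (coverValue-truncate c′) (≤-trans value≤ (N-max p isPacking)))

    tau-exists : Σ Carrier (IsTau H D)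
    tau-exists = T* , attained (argmin-sel id (weight allArcs) (map weight transversals)) , T*-min
      where
      weight : Subset m → Carrier
      weight T = sumOver T w
      allArcs : Subset m
      allArcs = replicate m true
      allArcs-transversal : IsHTransversal H D allArcs
      allArcs-transversal S copy = let e , Se = copy-nonEmpty S copy in e , Se , lookup-replicate e true
      transversals : List (Subset m)
      transversals = filter transversal? (allSubsets m)
      T* : Carrier
      T* = min (weight allArcs) (map weight transversals)
      T*-min : ∀ T → IsHTransversal H D T → T* ≤ weight T
      T*-min T tr = min≤v⁺ (weight allArcs) (map weight transversals)
                           (inj₂ (lose (∈-map⁺ weight (∈-filter⁺ transversal? (∈-allSubsets T) tr)) ≤-refl))
      attained : (T* ≡ weight allArcs) ⊎ (T* ∈ map weight transversals) → ∃ λ T → IsHTransversal H D T × weight T ≡ T*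
      attained (inj₁ T*≡) = allArcs , allArcs-transversal , sym T*≡
      attained (inj₂ T*∈) = let T , T∈ , T*≡ = ∈-map⁻ weight T*∈ in
                            T , proj₂ (∈-filter⁻ transversal? {xs = allSubsets m} T∈) , sym T*≡

module ArcDeletion (F : OrderedField) {k h n m} (H : Digraph k h) (D : WithField.WMultigraph F n (suc m)) (e : Fin (suc m)) where

  open import Relation.Binary.PropositionalEquality
  open import Data.Fin using (suc; punchIn; punchOut)
  open import Data.Fin.Properties using (punchIn-injective; punchIn-punchOut; punchOut-injective) renaming (_≟_ to _≟ᶠ_)
  open import Data.Vec using (lookup; insertAt; tabulate)
  open import Data.Vec.Properties using (insertAt-lookup; insertAt-punchIn; lookup∘tabulate)
  open import Data.Bool using (true; false; if_then_else_)
  open import Data.Bool.Properties using (¬-not) renaming (_≟_ to _≟ᵇ_)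
  open import Data.Product using (_,_; proj₁; proj₂; ∃)
  open import Data.Empty using (⊥-elim)
  open import Relation.Nullary using (¬_; yes; no)
  open import Function using (_∘_)
  open Subsets
  open HCopyDecidability

  open OrderedFieldProperties F
  open FieldSums F
  open WithField F
  open WMultigraph using (tl; hd; w)
  module D = HCopyCovers F H D
  module D∖e = HCopyCovers F H (deleteArc D e)

  private
    false≢true : false ≢ true
    false≢true ()

  sumOver-insertAt : ∀ (S : Subset m) t (f : Fin (suc m) → Carrier) →
                     sumOver (insertAt S e t) f ≡ (if t then f e else 0#) + sumOver S (f ∘ punchIn e)
  sumOver-insertAt S t f = trans (sumFin-remove e (λ i → if lookup (insertAt S e t) i then f i else 0#))
    (cong₂ _+_ (cong (λ s → if s then f e else 0#) (insertAt-lookup S e t))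
               (sumFin-cong (λ i → cong (λ s → if s then f (punchIn e i) else 0#) (insertAt-punchIn S e t i))))

  copy-insertAt : ∀ S → IsHCopy H (deleteArc D e) S → IsHCopy H D (insertAt S e false)
  copy-insertAt S (φ , ψ , inj-φ , inj-ψ , tl-ψ , hd-ψ , onto) =
    φ , punchIn e ∘ ψ , inj-φ , inj-ψ ∘ punchIn-injective e _ _ , tl-ψ , hd-ψ ,
    λ i → onto-punchIn i , λ a → trans (insertAt-punchIn S e false (ψ a)) (proj₂ (onto (ψ a)) a)
    where
    onto-punchIn : ∀ i → lookup (insertAt S e false) i ≡ true → ∃ λ a → punchIn e (ψ a) ≡ i
    onto-punchIn i Si with i ≟ᶠ e
    ... | yes refl = ⊥-elim (false≢true (trans (sym (insertAt-lookup S e false)) Si))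
    ... | no i≢e =
      let j = punchOut (i≢e ∘ sym)
          punchIn-j = punchIn-punchOut (i≢e ∘ sym)
          a , ψa≡j = proj₁ (onto j) (trans (sym (insertAt-punchIn S e false j))
                                           (trans (cong (lookup (insertAt S e false)) punchIn-j) Si))
      in a , trans (cong (punchIn e) ψa≡j) punchIn-j

  restrict : Subset (suc m) → Subset m
  restrict S = tabulate (lookup S ∘ punchIn e)

  copy-restrict : ∀ S → IsHCopy H D S → lookup S e ≡ false → IsHCopy H (deleteArc D e) (restrict S)
  copy-restrict S (φ , ψ , inj-φ , inj-ψ , tl-ψ , hd-ψ , onto) Se≡false =
    φ , ψ′ , inj-φ , (λ {a} {b} → inj-ψ ∘ punchOut-injective (e≢ψ a) (e≢ψ b)) ,
    (λ a → trans (cong (tl D) (punchIn-punchOut (e≢ψ a))) (tl-ψ a)) ,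
    (λ a → trans (cong (hd D) (punchIn-punchOut (e≢ψ a))) (hd-ψ a)) ,
    λ i → onto′ i ,
          λ a → trans (lookup∘tabulate _ (ψ′ a)) (trans (cong (lookup S) (punchIn-punchOut (e≢ψ a))) (proj₂ (onto e) a))
    where
    e≢ψ : ∀ a → e ≢ ψ a
    e≢ψ a e≡ψa = false≢true (trans (sym Se≡false) (trans (cong (lookup S) e≡ψa) (proj₂ (onto e) a)))
    ψ′ : Fin h → Fin m
    ψ′ a = punchOut (e≢ψ a)
    onto′ : ∀ i → lookup (restrict S) i ≡ true → ∃ λ a → ψ′ a ≡ i
    onto′ i Si = let a , ψa≡ = proj₁ (onto (punchIn e i)) (trans (sym (lookup∘tabulate _ i)) Si)
                 in a , punchIn-injective e _ _ (trans (punchIn-punchOut (e≢ψ a)) ψa≡)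

  transversal-insertAt : ∀ T → IsHTransversal H (deleteArc D e) T → IsHTransversal H D (insertAt T e true)
  transversal-insertAt T transversal S copy with lookup S e ≟ᵇ true
  ... | yes Se = e , Se , insertAt-lookup T e true
  ... | no ¬Se =
    let i , Si , Ti = transversal (restrict S) (copy-restrict S copy (¬-not ¬Se))
    in punchIn e i , trans (sym (lookup∘tabulate _ i)) Si , trans (insertAt-punchIn T e true i) Ti

  cover-restrict : ∀ {c} → D.IsCover c → D∖e.IsCover (c ∘ punchIn e)
  cover-restrict {c} (0≤c , covers) = 0≤c ∘ punchIn e ,
    λ S copy → subst (1# ≤_) (trans (sumOver-insertAt S false c) (+-identityˡ _))
                     (covers (insertAt S e false) (copy-insertAt S copy))

  coverValue-remove : ∀ c → coverValue D c ≡ w D e * c e + coverValue (deleteArc D e) (c ∘ punchIn e)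
  coverValue-remove c = sumFin-remove e (λ i → w D i * c i)

  tau≤w+tau-deleteArc : ∀ {T T′} → IsTau H D T → IsTau H (deleteArc D e) T′ → T ≤ w D e + T′
  tau≤w+tau-deleteArc (_ , T-min) ((T′ , transversal , weight≡) , _) =
    subst (_ ≤_) (trans (sumOver-insertAt T′ true (w D)) (cong (w D e +_) weight≡))
          (T-min (insertAt T′ e true) (transversal-insertAt T′ transversal))

  nuStar-deleteArc≤ : ∀ {N′ c} → IsNuStar H (deleteArc D e) N′ → IsFracCover H D c → N′ ≤ coverValue D c - w D e * c e
  nuStar-deleteArc≤ {c = c} nuStar isFracCover =
    subst (_ ≤_) (x+y≡z⇒x≡z-y (trans (+-comm _ _) (sym (coverValue-remove c))))
          (D∖e.nuStar≤value nuStar (cover-restrict (D.fracCover⇒cover isFracCover)))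

module ArcDeletionTheorem (F : OrderedField) where

  open import Data.Product using (proj₁; proj₂)

  open OrderedFieldProperties F
  open WithField F

  tau≤α⁻¹nuStar-deleteArc : ∀ {k h n m} (H : Digraph k h) → Fin h →
    (D : WMultigraph n (suc m)) (c : Fin (suc m) → Carrier) → IsMinFracCover H D c →
    (α : Carrier) → 0# < α → (e : Fin (suc m)) → α ≤ c e →
    (∀ T N → IsTau H (deleteArc D e) T → IsNuStar H (deleteArc D e) N → T ≤ α ⁻¹ * N) →
    (∀ T N → IsTau H D T → IsNuStar H D N → T ≤ α ⁻¹ * N)
  tau≤α⁻¹nuStar-deleteArc H a D c minCover α 0<α e α≤ce hypothesis T N isTau isNuStar = begin
    T                                ≤⟨ tau≤w+tau-deleteArc isTau isTau′ ⟩
    w D e + T′                       ≤⟨ +-monoʳ-≤ (w D e) (hypothesis T′ N′ isTau′ isNuStar′) ⟩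
    w D e + α ⁻¹ * N′                ≤⟨ +-monoʳ-≤ (w D e) (*-monoʳ-≤-nonNeg (α ⁻¹) (⁻¹-nonNeg 0<α) N′≤N-w*α) ⟩
    w D e + α ⁻¹ * (N - w D e * α)   ≡⟨ x+y⁻¹*[z-x*y]≡y⁻¹*z (w D e) N 0<α ⟩
    α ⁻¹ * N                         ∎
    where
    open ≤-Reasoning
    open WMultigraph using (w; w≥0)
    open ArcDeletion F H D e
    T′ = proj₁ (D∖e.tau-exists a)
    isTau′ = proj₂ (D∖e.tau-exists a)
    N′ = proj₁ (D∖e.nuStar-exists a)
    isNuStar′ = proj₂ (D∖e.nuStar-exists a)
    N′≤N-w*α : N′ ≤ N - w D e * α
    N′≤N-w*α = ≤-trans (nuStar-deleteArc≤ isNuStar′ (proj₁ minCover))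
      (+-mono-≤ (D.minFracCover≤nuStar a minCover isNuStar) (neg-antimono-≤ (*-monoʳ-≤-nonNeg (w D e) (w≥0 D e) α≤ce)))

open import Data.Nat using (_≤_; s≤s)
open import Data.Fin using (zero)
open import Data.Product using (_×_)
open OrderedField using (Carrier; 0#; _⁻¹)
open WithField using (WMultigraph; IsMinFracCover; deleteArc; IsTau; IsNuStar)

lemma4p1 : (F : OrderedField) →
    ∀ {k h n m} (H : Digraph k h) → 2 ≤ h →
    (D : WMultigraph F n (suc m)) (c : Fin (suc m) → Carrier F) → IsMinFracCover F H D c →
    (α : Carrier F) → OrderedField._<_ F (0# F) α →
    (e : Fin (suc m)) → OrderedField._≤_ F α (c e) →
    (∀ T N → IsTau F H (deleteArc F D e) T → IsNuStar F H (deleteArc F D e) N →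
      OrderedField._≤_ F T (OrderedField._*_ F (_⁻¹ F α) N)) →
    (∀ T N → IsTau F H D T → IsNuStar F H D N →
      OrderedField._≤_ F T (OrderedField._*_ F (_⁻¹ F α) N))
lemma4p1 F H (s≤s _) = ArcDeletionTheorem.tau≤α⁻¹nuStar-deleteArc F H zero
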